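{- Let $m\geq 2$ be an integer and let $p>3$ be a prime with $p\neq m$. Then $$\mathcal{H}_{p,m}(p-1)\equiv-\frac{\mathcal{T}^*_{p,m}(2p)+2}{4p}-\frac{p}{2}\sum_{\substack{1\leq r\leq m\\ 2r\not\equiv p\pmod m}}\mathcal{H}_{r,m}(p-1)^2\pmod{p^2}.$$
   Context: For integers $r$, $m\geq 1$, $n\geq 0$ define $\mathcal{H}_{r,m}(n)=\sum_{1\leq k\leq n,\ k\equiv r \pmod m}\frac{1}{k}$ and $\mathcal{T}^*_{r,m}(n)=\sum_{0\leq k\leq n,\ k\equiv r\pmod m}(-1)^k\binom{n}{k}$. For rational numbers $a,b$ and a prime $p$, $a\equiv b\pmod{p^2}$ means that $(a-b)/p^2$, written in lowest terms, has denominator not divisible by $p$. -}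

module Defs where

open import Data.Nat as ℕ using (ℕ; zero; suc; _%_)
open import Data.Nat.Combinatorics using (_C_)
open import Data.Integer as ℤ using (ℤ; +_)
open import Data.Rational as ℚ using (ℚ; _/_; ↧ₙ_)
open import Data.Bool using (Bool; if_then_else_)
open import Relation.Nullary using (¬_)
open import Relation.Nullary.Decidable using (⌊_⌋)
open import Data.Nat.Divisibility using (_∣_)

congB : ℕ → ℕ → ℕ → Bool
congB k r zero    = ⌊ k ℕ.≟ r ⌋
congB k r (suc m) = ⌊ k % suc m ℕ.≟ r % suc m ⌋

-- 1 / n as a rational (junk value 0 for n = 0; never used at 0 below)
invℕ : ℕ → ℚ
invℕ zero    = ℚ.0ℚ
invℕ (suc n) = + 1 / suc n

H : ℕ → ℕ → ℕ → ℚ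
H r m zero    = ℚ.0ℚ
H r m (suc n) = H r m n ℚ.+ (if congB (suc n) r m then invℕ (suc n) else ℚ.0ℚ)

sgn : ℕ → ℤ
sgn zero          = + 1
sgn (suc zero)    = ℤ.- (+ 1)
sgn (suc (suc k)) = sgn k

Tpart : ℕ → ℕ → ℕ → ℕ → ℤ
Tpart r m n zero    = if congB 0 r m then sgn 0 ℤ.* (+ (n C 0)) else + 0
Tpart r m n (suc j) = Tpart r m n j ℤ.+
  (if congB (suc j) r m then sgn (suc j) ℤ.* (+ (n C suc j)) else + 0)

Tstar : ℕ → ℕ → ℕ → ℤ
Tstar r m n = Tpart r m n n

Ssq : ℕ → ℕ → ℕ → ℕ → ℚ
Ssq p m n zero    = ℚ.0ℚ
Ssq p m n (suc j) = Ssq p m n j ℚ.+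
  (if congB (2 ℕ.* suc j) p m then ℚ.0ℚ else H (suc j) m n ℚ.* H (suc j) m n)

-- a ≡ b (mod p²) for rationals: (a - b)/p² in lowest terms has denominator not divisible by p
_≡_[modsq_] : ℚ → ℚ → ℕ → Set
a ≡ b [modsq p ] = ¬ (p ∣ ↧ₙ ((a ℚ.- b) ℚ.* invℕ (p ℕ.* p)))

module Submission where

open import Defs
open import Data.Nat as ℕ using (ℕ; _≤_; _<_; _∸_)
open import Data.Nat.Primality using (Prime)
open import Data.Integer as ℤ using (+_)
open import Data.Rational as ℚ using (ℚ; _/_)
open import Relation.Binary.PropositionalEquality using (_≢_)

-- Write p = 2h+1, N = p-1, and x ≈[ k ] y when x - y is p^k times a p-integral rational.
--  1. Wolstenholme-type facts (module Wolstenholme): Σ_{k≤N} 1/k² ≡ 0 (mod p),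
--     H_N ≡ 0 (mod p²) and e₂ = Σ_{j<k≤N} 1/(jk) ≡ 0 (mod p).
--  2. (module BinomialExpansion) (-1)^k C(2p-1,k) = Π_{i≤k} (1 - 2p/i) ≡ 1 - 2p H_k + 4p² e₂(k),
--     so (-1)^k C(2p,k) ≡ -2p/k + 4p² H_{k-1}/k for 0 < k < p and C(2p,p) ≡ 2 (mod p³).
--  3. (module MainCongruence) Pairing k with 2p - k in T*_{p,m}(2p) gives
--     T*_{p,m}(2p) + 2 ≡ -4p·H_{p,m}(p-1) + 8p²·E (mod p³), with E = Σ_{k≤N, k≡p} H_{k-1}/k.
--  4. (module ClassSums) Modulo p, the reflection k ↦ p - k and the identity
--     1/(ab) + 1/(bc) + 1/(ca) = p/(abc) for a + b + c = p give 4E + Σ'_r H_{r,m}(p-1)² ≡ 0.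
-- Dividing 3 by -4p and inserting 4 yields the theorem.

open import Data.Nat using (zero; suc; z≤n; s≤s)
open import Data.Nat.Primality using (euclidsLemma; prime⇒irreducible)
open import Data.Nat.DivMod using (m≡m%n+[m/n]*n; m%n<n)
open import Data.Nat.Divisibility using (_∣_; divides)
open import Data.Nat.Combinatorics using (_C_)
import Data.Nat.Properties as NP
open import Data.Integer using (ℤ)
import Data.Integer.Properties as ZP
open import Data.Rational using (0ℚ; 1ℚ; ↧ₙ_; toℚᵘ)
import Data.Rational.Properties as QP
import Data.Rational.Unnormalised as U
import Data.Rational.Unnormalised.Properties as UP
open import Relation.Binary.PropositionalEquality
  using (_≡_; refl; sym; trans; cong; cong₂; subst; module ≡-Reasoning)
open import Data.Rational.Solver using (module +-*-Solver)
open +-*-Solver using (solve; _:+_; _:*_; _:-_; :-_; _:=_; con)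
open import Data.Product using (Σ; ∃-syntax; _,_)
open import Data.Bool using (Bool; true; false; if_then_else_)
open import Relation.Nullary using (¬_; yes; no)
open import Data.Sum using (inj₁; inj₂)
open import Data.Empty using (⊥-elim)

module Casts where

  ι : ℤ → ℚ
  ι i = i / 1

  n̂ : ℕ → ℚ
  n̂ k = ι (+ k)

  viaℚᵘ : ∀ {x y} u v → toℚᵘ x U.≃ u → toℚᵘ y U.≃ v → u U.≃ v → x ≡ y
  viaℚᵘ u v ex ey uv = QP.toℚᵘ-injective (UP.≃-trans ex (UP.≃-trans uv (UP.≃-sym ey)))

  toℚᵘ-/ : ∀ i n → toℚᵘ (i / suc n) U.≃ U.mkℚᵘ i n
  toℚᵘ-/ i n = QP.toℚᵘ-fromℚᵘ (U.mkℚᵘ i n)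

  ι-+ : ∀ a b → ι (a ℤ.+ b) ≡ ι a ℚ.+ ι b
  ι-+ a b = viaℚᵘ _ _ (toℚᵘ-/ (a ℤ.+ b) 0)
    (UP.≃-trans (QP.toℚᵘ-homo-+ (ι a) (ι b)) (UP.+-cong (toℚᵘ-/ a 0) (toℚᵘ-/ b 0)))
    (U.*≡* (cong (ℤ._* + 1) (sym (cong₂ ℤ._+_ (ZP.*-identityʳ a) (ZP.*-identityʳ b)))))

  ι-* : ∀ a b → ι (a ℤ.* b) ≡ ι a ℚ.* ι b
  ι-* a b = viaℚᵘ _ _ (toℚᵘ-/ (a ℤ.* b) 0)
    (UP.≃-trans (QP.toℚᵘ-homo-* (ι a) (ι b)) (UP.*-cong (toℚᵘ-/ a 0) (toℚᵘ-/ b 0)))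
    (U.*≡* refl)

  ι-neg : ∀ a → ι (ℤ.- a) ≡ ℚ.- ι a
  ι-neg a = viaℚᵘ _ _ (toℚᵘ-/ (ℤ.- a) 0)
    (UP.≃-trans (QP.toℚᵘ-homo‿- (ι a)) (UP.-‿cong (toℚᵘ-/ a 0)))
    (U.*≡* refl)

  n̂-+ : ∀ a b → n̂ (a ℕ.+ b) ≡ n̂ a ℚ.+ n̂ b
  n̂-+ a b = trans (cong ι (ZP.pos-+ a b)) (ι-+ (+ a) (+ b))

  n̂-* : ∀ a b → n̂ (a ℕ.* b) ≡ n̂ a ℚ.* n̂ b
  n̂-* a b = trans (cong ι (ZP.pos-* a b)) (ι-* (+ a) (+ b))

  invℕ-cancel : ∀ k → 0 < k → invℕ k ℚ.* n̂ k ≡ 1ℚ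
  invℕ-cancel (suc n) _ = viaℚᵘ _ _
    (UP.≃-trans (QP.toℚᵘ-homo-* (invℕ (suc n)) (n̂ (suc n)))
                (UP.*-cong (toℚᵘ-/ (+ 1) n) (toℚᵘ-/ (+ suc n) 0)))
    UP.≃-refl
    (U.*≡* (trans (ZP.*-identityʳ _) (trans (ZP.*-identityˡ (+ suc n))
             (trans (cong +_ (sym (NP.*-identityʳ (suc n)))) (sym (ZP.*-identityˡ _))))))

  invℕ-* : ∀ a b → 0 < a → 0 < b → invℕ (a ℕ.* b) ≡ invℕ a ℚ.* invℕ b
  invℕ-* (suc a) (suc b) _ _ = viaℚᵘ _ _ (toℚᵘ-/ (+ 1) (b ℕ.+ a ℕ.* suc b))
    (UP.≃-trans (QP.toℚᵘ-homo-* (invℕ (suc a)) (invℕ (suc b)))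
                (UP.*-cong (toℚᵘ-/ (+ 1) a) (toℚᵘ-/ (+ 1) b)))
    (U.*≡* refl)

  /-split : ∀ i n → i / suc n ≡ ι i ℚ.* invℕ (suc n)
  /-split i n = viaℚᵘ _ _ (toℚᵘ-/ i n)
    (UP.≃-trans (QP.toℚᵘ-homo-* (ι i) (invℕ (suc n))) (UP.*-cong (toℚᵘ-/ i 0) (toℚᵘ-/ (+ 1) n)))
    (U.*≡* (trans (cong (λ k → i ℤ.* + suc k) (NP.+-identityʳ n))
                  (cong (ℤ._* + suc n) (sym (ZP.*-identityʳ i)))))

  inv-triple : ∀ a b c n → 0 < a → 0 < b → 0 < c → (a ℕ.+ b) ℕ.+ c ≡ n →
    invℕ a ℚ.* invℕ b ℚ.+ invℕ b ℚ.* invℕ c ℚ.+ invℕ a ℚ.* invℕ c ≡ n̂ n ℚ.* (invℕ a ℚ.* invℕ b ℚ.* invℕ c)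
  inv-triple a b c n pa pb pc sum≡n = begin
      ia ℚ.* ib ℚ.+ ib ℚ.* ic ℚ.+ ia ℚ.* ic
        ≡⟨ sym (cong₂ ℚ._+_ (cong₂ ℚ._+_ (QP.*-identityʳ (ia ℚ.* ib)) (QP.*-identityʳ (ib ℚ.* ic))) (QP.*-identityʳ (ia ℚ.* ic))) ⟩
      ia ℚ.* ib ℚ.* 1ℚ ℚ.+ ib ℚ.* ic ℚ.* 1ℚ ℚ.+ ia ℚ.* ic ℚ.* 1ℚ
        ≡⟨ cong₂ ℚ._+_ (cong₂ (λ u v → ia ℚ.* ib ℚ.* u ℚ.+ ib ℚ.* ic ℚ.* v) (sym (invℕ-cancel c pc)) (sym (invℕ-cancel a pa)))
                       (cong (ia ℚ.* ic ℚ.*_) (sym (invℕ-cancel b pb))) ⟩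
      ia ℚ.* ib ℚ.* (ic ℚ.* n̂ c) ℚ.+ ib ℚ.* ic ℚ.* (ia ℚ.* n̂ a) ℚ.+ ia ℚ.* ic ℚ.* (ib ℚ.* n̂ b)
        ≡⟨ solve 6 (λ x y z u v w → x :* y :* (z :* w) :+ y :* z :* (x :* u) :+ x :* z :* (y :* v) := (u :+ v :+ w) :* (x :* y :* z))
                   refl ia ib ic (n̂ a) (n̂ b) (n̂ c) ⟩
      (n̂ a ℚ.+ n̂ b ℚ.+ n̂ c) ℚ.* (ia ℚ.* ib ℚ.* ic)
        ≡⟨ cong (ℚ._* (ia ℚ.* ib ℚ.* ic)) (trans (cong (ℚ._+ n̂ c) (sym (n̂-+ a b))) (trans (sym (n̂-+ (a ℕ.+ b) c)) (cong n̂ sum≡n))) ⟩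
      n̂ n ℚ.* (ia ℚ.* ib ℚ.* ic) ∎
    where
    open ≡-Reasoning
    ia = invℕ a
    ib = invℕ b
    ic = invℕ c

module Sums where

  open Data.Rational using (_+_; _*_; -_)

  ∑ : ℕ → (ℕ → ℚ) → ℚ
  ∑ zero f = 0ℚ
  ∑ (suc n) f = ∑ n f + f (suc n)

  ∑-cong : ∀ n {f g : ℕ → ℚ} → (∀ i → 0 < i → i ≤ n → f i ≡ g i) → ∑ n f ≡ ∑ n g
  ∑-cong zero h = refl
  ∑-cong (suc n) h = cong₂ _+_ (∑-cong n (λ i a b → h i a (NP.m≤n⇒m≤1+n b))) (h (suc n) (s≤s z≤n) NP.≤-refl)

  ∑-ext : ∀ n {f g : ℕ → ℚ} → (∀ i → f i ≡ g i) → ∑ n f ≡ ∑ n g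
  ∑-ext n h = ∑-cong n (λ i _ _ → h i)

  ∑-+ : ∀ n (f g : ℕ → ℚ) → ∑ n (λ i → f i + g i) ≡ ∑ n f + ∑ n g
  ∑-+ zero f g = refl
  ∑-+ (suc n) f g = trans (cong (_+ (f (suc n) + g (suc n))) (∑-+ n f g))
    (solve 4 (λ a b c d → (a :+ b) :+ (c :+ d) := (a :+ c) :+ (b :+ d)) refl (∑ n f) (∑ n g) (f (suc n)) (g (suc n)))

  ∑-* : ∀ n c (f : ℕ → ℚ) → ∑ n (λ i → c * f i) ≡ c * ∑ n f
  ∑-* zero c f = sym (QP.*-zeroʳ c)
  ∑-* (suc n) c f = trans (cong (_+ (c * f (suc n))) (∑-* n c f)) (sym (QP.*-distribˡ-+ c (∑ n f) (f (suc n))))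

  ∑-*ʳ : ∀ n c (f : ℕ → ℚ) → ∑ n (λ i → f i * c) ≡ ∑ n f * c
  ∑-*ʳ n c f = trans (∑-ext n (λ i → QP.*-comm (f i) c)) (trans (∑-* n c f) (QP.*-comm c (∑ n f)))

  ∑-neg : ∀ n (f : ℕ → ℚ) → ∑ n (λ i → - f i) ≡ - ∑ n f
  ∑-neg zero f = refl
  ∑-neg (suc n) f = trans (cong (_+ (- f (suc n))) (∑-neg n f)) (sym (QP.neg-distrib-+ (∑ n f) (f (suc n))))

  ∑-0 : ∀ n → ∑ n (λ _ → 0ℚ) ≡ 0ℚ
  ∑-0 zero = refl
  ∑-0 (suc n) = trans (QP.+-identityʳ _) (∑-0 n)

  ∑-first : ∀ n (f : ℕ → ℚ) → ∑ (suc n) f ≡ f 1 + ∑ n (λ i → f (suc i))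
  ∑-first zero f = QP.+-comm 0ℚ (f 1)
  ∑-first (suc n) f = trans (cong (_+ f (suc (suc n))) (∑-first n f)) (QP.+-assoc (f 1) _ _)

  ∑-split : ∀ a b (f : ℕ → ℚ) → ∑ (a ℕ.+ b) f ≡ ∑ a f + ∑ b (λ i → f (a ℕ.+ i))
  ∑-split a zero f = trans (cong (λ k → ∑ k f) (NP.+-identityʳ a)) (sym (QP.+-identityʳ (∑ a f)))
  ∑-split a (suc b) f = begin
      ∑ (a ℕ.+ suc b) f                                   ≡⟨ cong (λ k → ∑ k f) (NP.+-suc a b) ⟩
      ∑ (a ℕ.+ b) f + f (suc (a ℕ.+ b))                   ≡⟨ cong₂ _+_ (∑-split a b f) (cong f (sym (NP.+-suc a b))) ⟩
      (∑ a f + ∑ b (λ i → f (a ℕ.+ i))) + f (a ℕ.+ suc b) ≡⟨ QP.+-assoc (∑ a f) _ (f (a ℕ.+ suc b)) ⟩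
      ∑ a f + ∑ (suc b) (λ i → f (a ℕ.+ i))               ∎
    where open ≡-Reasoning

  ∑-rev : ∀ n (f : ℕ → ℚ) → ∑ n f ≡ ∑ n (λ i → f (suc n ∸ i))
  ∑-rev zero f = refl
  ∑-rev (suc n) f = begin
      ∑ n f + f (suc n)                     ≡⟨ cong (_+ f (suc n)) (∑-rev n f) ⟩
      ∑ n (λ i → f (suc n ∸ i)) + f (suc n) ≡⟨ QP.+-comm (∑ n (λ i → f (suc n ∸ i))) (f (suc n)) ⟩
      f (suc n) + ∑ n (λ i → f (suc n ∸ i)) ≡⟨ sym (∑-first n (λ i → f (suc (suc n) ∸ i))) ⟩
      ∑ (suc n) (λ i → f (suc (suc n) ∸ i)) ∎
    where open ≡-Reasoning

  ∑-swap : ∀ n k (g : ℕ → ℕ → ℚ) → ∑ n (λ i → ∑ k (λ j → g i j)) ≡ ∑ k (λ j → ∑ n (λ i → g i j))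
  ∑-swap zero k g = sym (∑-0 k)
  ∑-swap (suc n) k g = begin
      ∑ n (λ i → ∑ k (g i)) + ∑ k (g (suc n))         ≡⟨ cong (_+ ∑ k (g (suc n))) (∑-swap n k g) ⟩
      ∑ k (λ j → ∑ n (λ i → g i j)) + ∑ k (g (suc n)) ≡⟨ sym (∑-+ k _ _) ⟩
      ∑ k (λ j → ∑ (suc n) (λ i → g i j))             ∎
    where open ≡-Reasoning

  ∑-mul : ∀ n k (f g : ℕ → ℚ) → ∑ n f * ∑ k g ≡ ∑ n (λ i → ∑ k (λ j → f i * g j))
  ∑-mul n k f g = trans (sym (∑-*ʳ n (∑ k g) f)) (∑-ext n (λ i → sym (∑-* k (f i) g)))

  ∑-pair : ∀ h (f : ℕ → ℚ) → ∑ (h ℕ.+ h) f ≡ ∑ h (λ i → f (i ℕ.+ i ∸ 1) + f (i ℕ.+ i))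
  ∑-pair zero f = refl
  ∑-pair (suc h) f = begin
      ∑ (suc h ℕ.+ suc h) f
        ≡⟨ cong (λ k → ∑ (suc k) f) (NP.+-suc h h) ⟩
      (∑ (h ℕ.+ h) f + f (suc (h ℕ.+ h))) + f (suc (suc (h ℕ.+ h)))
        ≡⟨ cong (λ z → (z + f (suc (h ℕ.+ h))) + f (suc (suc (h ℕ.+ h)))) (∑-pair h f) ⟩
      (S + f (suc (h ℕ.+ h))) + f (suc (suc (h ℕ.+ h)))
        ≡⟨ QP.+-assoc S (f (suc (h ℕ.+ h))) (f (suc (suc (h ℕ.+ h)))) ⟩
      S + (f (suc (h ℕ.+ h)) + f (suc (suc (h ℕ.+ h))))
        ≡⟨ cong (λ k → S + (f k + f (suc k))) (sym (NP.+-suc h h)) ⟩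
      S + (f (h ℕ.+ suc h) + f (suc (h ℕ.+ suc h))) ∎
    where
    open ≡-Reasoning
    S = ∑ h (λ i → f (i ℕ.+ i ∸ 1) + f (i ℕ.+ i))

  -- Double sums over the anti-triangle {a, b ≥ 1, a + b ≤ n}, the triangle
  -- {1 ≤ j < k ≤ n} and the square {1 ≤ j, k ≤ n}.
  AT : ℕ → (ℕ → ℕ → ℚ) → ℚ
  AT n f = ∑ n (λ a → ∑ (n ∸ a) (λ b → f a b))

  Tri : ℕ → (ℕ → ℕ → ℚ) → ℚ
  Tri n g = ∑ n (λ k → ∑ (k ∸ 1) (λ j → g j k))

  Sq : ℕ → (ℕ → ℕ → ℚ) → ℚ
  Sq n s = ∑ n (λ j → ∑ n (λ k → s j k))

  private
    sn∸a : ∀ {n a} → a ≤ n → suc n ∸ a ≡ suc (n ∸ a)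
    sn∸a le = NP.+-∸-assoc 1 le

  AT-step : ∀ n f → AT (suc n) f ≡ AT n f + ∑ n (λ a → f a (suc n ∸ a))
  AT-step n f = begin
      ∑ n (λ a → ∑ (suc n ∸ a) (f a)) + ∑ (n ∸ n) (f (suc n))
        ≡⟨ cong₂ _+_ (∑-cong n (λ a _ le → cong (λ k → ∑ k (f a)) (sn∸a le)))
                     (cong (λ k → ∑ k (f (suc n))) (NP.n∸n≡0 n)) ⟩
      ∑ n (λ a → ∑ (n ∸ a) (f a) + f a (suc (n ∸ a))) + 0ℚ
        ≡⟨ QP.+-identityʳ _ ⟩
      ∑ n (λ a → ∑ (n ∸ a) (f a) + f a (suc (n ∸ a)))
        ≡⟨ ∑-+ n _ _ ⟩
      AT n f + ∑ n (λ a → f a (suc (n ∸ a)))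
        ≡⟨ cong (λ z → AT n f + z) (∑-cong n (λ a _ le → cong (f a) (sym (sn∸a le)))) ⟩
      AT n f + ∑ n (λ a → f a (suc n ∸ a)) ∎
    where open ≡-Reasoning

  AT-range : ∀ {n a b} → a ≤ n → b ≤ n ∸ a → a ℕ.+ b ≤ n
  AT-range {n} {a} {b} a≤n b≤ = subst (a ℕ.+ b ≤_) (NP.m+[n∸m]≡n a≤n) (NP.+-monoʳ-≤ a b≤)

  AT-ext : ∀ n {f g} → (∀ a b → 0 < a → 0 < b → a ℕ.+ b ≤ n → f a b ≡ g a b) → AT n f ≡ AT n g
  AT-ext n h = ∑-cong n (λ a a>0 a≤n → ∑-cong (n ∸ a) (λ b b>0 b≤ → h a b a>0 b>0 (AT-range a≤n b≤)))

  AT-swap : ∀ n f → AT n f ≡ AT n (λ a b → f b a)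
  AT-swap zero f = refl
  AT-swap (suc n) f = begin
      AT (suc n) f                                                  ≡⟨ AT-step n f ⟩
      AT n f + ∑ n (λ a → f a (suc n ∸ a))                          ≡⟨ cong₂ _+_ (AT-swap n f) (∑-rev n _) ⟩
      AT n (λ a b → f b a) + ∑ n (λ i → f (suc n ∸ i) (suc n ∸ (suc n ∸ i)))
        ≡⟨ cong (λ z → AT n (λ a b → f b a) + z)
                (∑-cong n (λ i _ le → cong (f (suc n ∸ i)) (NP.m∸[m∸n]≡n (NP.m≤n⇒m≤1+n le)))) ⟩
      AT n (λ a b → f b a) + ∑ n (λ i → f (suc n ∸ i) i)            ≡⟨ sym (AT-step n (λ a b → f b a)) ⟩
      AT (suc n) (λ a b → f b a) ∎
    where open ≡-Reasoning

  AT-rin : ∀ n f → AT n f ≡ AT n (λ a b → f a (suc n ∸ a ∸ b))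
  AT-rin n f = ∑-cong n (λ a _ le → trans (∑-rev (n ∸ a) (f a))
    (∑-ext (n ∸ a) (λ b → cong (λ k → f a (k ∸ b)) (sym (sn∸a le)))))

  Tri-AT : ∀ n g → Tri n g ≡ AT n (λ a b → g a (a ℕ.+ b))
  Tri-AT zero g = refl
  Tri-AT (suc n) g = begin
      Tri n g + ∑ n (λ j → g j (suc n))
        ≡⟨ cong₂ _+_ (Tri-AT n g) (∑-cong n (λ a _ le → cong (g a) (sym (NP.m+[n∸m]≡n (NP.m≤n⇒m≤1+n le))))) ⟩
      AT n (λ a b → g a (a ℕ.+ b)) + ∑ n (λ a → g a (a ℕ.+ (suc n ∸ a)))
        ≡⟨ sym (AT-step n (λ a b → g a (a ℕ.+ b))) ⟩
      AT (suc n) (λ a b → g a (a ℕ.+ b)) ∎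
    where open ≡-Reasoning

  Sq-Tri : ∀ n s → Sq n s ≡ ∑ n (λ k → s k k) + Tri n (λ j k → s j k + s k j)
  Sq-Tri zero s = refl
  Sq-Tri (suc n) s = begin
      ∑ n (λ j → ∑ n (s j) + s j (suc n)) + (∑ n (s (suc n)) + s (suc n) (suc n))
        ≡⟨ cong (_+ (B + d)) (∑-+ n _ _) ⟩
      (Sq n s + A) + (B + d)
        ≡⟨ cong (λ z → (z + A) + (B + d)) (Sq-Tri n s) ⟩
      ((Dg + Tr) + A) + (B + d)
        ≡⟨ solve 5 (λ Dg Tr A B d → ((Dg :+ Tr) :+ A) :+ (B :+ d) := (Dg :+ d) :+ (Tr :+ (A :+ B))) refl Dg Tr A B d ⟩
      (Dg + d) + (Tr + (A + B))
        ≡⟨ cong (λ z → (Dg + d) + (Tr + z)) (sym (∑-+ n _ _)) ⟩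
      ∑ (suc n) (λ k → s k k) + Tri (suc n) (λ j k → s j k + s k j) ∎
    where
    open ≡-Reasoning
    A = ∑ n (λ j → s j (suc n))
    B = ∑ n (s (suc n))
    d = s (suc n) (suc n)
    Dg = ∑ n (λ k → s k k)
    Tr = Tri n (λ j k → s j k + s k j)

  Tri-+ : ∀ n f g → Tri n (λ j k → f j k + g j k) ≡ Tri n f + Tri n g
  Tri-+ n f g = trans (∑-ext n (λ k → ∑-+ (k ∸ 1) (λ j → f j k) (λ j → g j k))) (∑-+ n _ _)

  Tri-ext : ∀ n {f g} → (∀ j k → f j k ≡ g j k) → Tri n f ≡ Tri n g
  Tri-ext n h = ∑-ext n (λ k → ∑-ext (k ∸ 1) (λ j → h j k))

  AT-+ : ∀ n f g → AT n (λ a b → f a b + g a b) ≡ AT n f + AT n g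
  AT-+ n f g = trans (∑-ext n (λ a → ∑-+ (n ∸ a) (f a) (g a))) (∑-+ n _ _)

  AT-neg : ∀ n f → AT n (λ a b → - f a b) ≡ - AT n f
  AT-neg n f = trans (∑-ext n (λ a → ∑-neg (n ∸ a) (f a))) (∑-neg n _)

  AT-* : ∀ n c f → AT n (λ a b → c * f a b) ≡ c * AT n f
  AT-* n c f = trans (∑-ext n (λ a → ∑-* (n ∸ a) c (f a))) (∑-* n c _)

module Selection where

  open Sums

  sel : Bool → ℚ → ℚ
  sel b x = if b then x else 0ℚ

  sel-idem : ∀ b x → sel b (sel b x) ≡ sel b x
  sel-idem true x = refl
  sel-idem false x = refl

  sel-neg : ∀ b x → sel b (ℚ.- x) ≡ ℚ.- sel b x
  sel-neg true x = refl
  sel-neg false x = refl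

  sel-+ : ∀ b x y → sel b (x ℚ.+ y) ≡ sel b x ℚ.+ sel b y
  sel-+ true x y = refl
  sel-+ false x y = refl

  sel-* : ∀ b c x → sel b (c ℚ.* x) ≡ c ℚ.* sel b x
  sel-* true c x = refl
  sel-* false c x = sym (QP.*-zeroʳ c)

  sel-mul : ∀ a b x y → sel a x ℚ.* sel b y ≡ sel a (sel b (x ℚ.* y))
  sel-mul true true x y = refl
  sel-mul true false x y = QP.*-zeroʳ x
  sel-mul false b x y = QP.*-zeroˡ (sel b y)

  sel-∑ : ∀ b n f → sel b (∑ n f) ≡ ∑ n (λ i → sel b (f i))
  sel-∑ true n f = refl
  sel-∑ false n f = sym (∑-0 n)

module Residues (m' : ℕ) where

  open import Data.Nat using (_%_)
  open import Data.Nat.DivMod using ([m+kn]%n≡m%n; m<n⇒m%n≡m; n%n≡0)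
  open import Relation.Nullary.Decidable using (⌊_⌋)
  import Data.Nat.Solver as NS
  open NS.+-*-Solver using () renaming (solve to solveℕ; _:+_ to _⊕_; _:*_ to _⊗_; _:=_ to _⊜_)
  open Sums
  open Selection

  M : ℕ
  M = suc m'

  Cg : ℕ → ℕ → Set
  Cg a b = Σ ℕ λ x → Σ ℕ λ y → a ℕ.+ x ℕ.* M ≡ b ℕ.+ y ℕ.* M

  congB→Cg : ∀ a b → congB a b M ≡ true → Cg a b
  congB→Cg a b h with a % M ℕ.≟ b % M
  ... | yes e = b ℕ./ M , a ℕ./ M , (begin
      a ℕ.+ b/M                          ≡⟨ cong (ℕ._+ b/M) (m≡m%n+[m/n]*n a M) ⟩
      (a % M ℕ.+ a/M) ℕ.+ b/M            ≡⟨ cong (λ z → (z ℕ.+ a/M) ℕ.+ b/M) e ⟩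
      (b % M ℕ.+ a/M) ℕ.+ b/M            ≡⟨ solveℕ 3 (λ u v w → (u ⊕ v) ⊕ w ⊜ (u ⊕ w) ⊕ v) refl (b % M) a/M b/M ⟩
      (b % M ℕ.+ b/M) ℕ.+ a/M            ≡⟨ cong (ℕ._+ a/M) (sym (m≡m%n+[m/n]*n b M)) ⟩
      b ℕ.+ a/M                          ∎)
    where
    open ≡-Reasoning
    a/M = a ℕ./ M ℕ.* M
    b/M = b ℕ./ M ℕ.* M

  Cg→congB : ∀ a b → Cg a b → congB a b M ≡ true
  Cg→congB a b (x , y , e) with a % M ℕ.≟ b % M
  ... | yes _ = refl
  ... | no ne = ⊥-elim (ne (trans (sym ([m+kn]%n≡m%n a x M)) (trans (cong (_% M) e) ([m+kn]%n≡m%n b y M))))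

  ¬Cg→congB : ∀ a b → ¬ Cg a b → congB a b M ≡ false
  ¬Cg→congB a b n with congB a b M in eq
  ... | true = ⊥-elim (n (congB→Cg a b eq))
  ... | false = refl

  congB-≡ : ∀ a b c d → (Cg a b → Cg c d) → (Cg c d → Cg a b) → congB a b M ≡ congB c d M
  congB-≡ a b c d f g with congB a b M in e1 | congB c d M in e2
  ... | true  | true  = refl
  ... | false | false = refl
  ... | true  | false with () ← trans (sym (Cg→congB c d (f (congB→Cg a b e1)))) e2
  ... | false | true  with () ← trans (sym (Cg→congB a b (g (congB→Cg c d e2)))) e1

  Cg-refl : ∀ a → Cg a a
  Cg-refl a = 0 , 0 , refl

  Cg-sym : ∀ {a b} → Cg a b → Cg b a
  Cg-sym (x , y , e) = y , x , sym e

  Cg-trans : ∀ {a b c} → Cg a b → Cg b c → Cg a c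
  Cg-trans {a} {b} {c} (x , y , e) (u , v , f) = x ℕ.+ u , y ℕ.+ v , (begin
      a ℕ.+ (x ℕ.+ u) ℕ.* M          ≡⟨ solveℕ 4 (λ a x u M → a ⊕ (x ⊕ u) ⊗ M ⊜ (a ⊕ x ⊗ M) ⊕ u ⊗ M) refl a x u M ⟩
      (a ℕ.+ x ℕ.* M) ℕ.+ u ℕ.* M    ≡⟨ cong (ℕ._+ u ℕ.* M) e ⟩
      (b ℕ.+ y ℕ.* M) ℕ.+ u ℕ.* M    ≡⟨ solveℕ 4 (λ b y u M → (b ⊕ y ⊗ M) ⊕ u ⊗ M ⊜ (b ⊕ u ⊗ M) ⊕ y ⊗ M) refl b y u M ⟩
      (b ℕ.+ u ℕ.* M) ℕ.+ y ℕ.* M    ≡⟨ cong (ℕ._+ y ℕ.* M) f ⟩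
      (c ℕ.+ v ℕ.* M) ℕ.+ y ℕ.* M    ≡⟨ solveℕ 4 (λ c v y M → (c ⊕ v ⊗ M) ⊕ y ⊗ M ⊜ c ⊕ (y ⊕ v) ⊗ M) refl c v y M ⟩
      c ℕ.+ (y ℕ.+ v) ℕ.* M          ∎)
    where open ≡-Reasoning

  Cg-+ : ∀ {a b c d} → Cg a b → Cg c d → Cg (a ℕ.+ c) (b ℕ.+ d)
  Cg-+ {a} {b} {c} {d} (x , y , e) (u , v , f) = x ℕ.+ u , y ℕ.+ v , (begin
      (a ℕ.+ c) ℕ.+ (x ℕ.+ u) ℕ.* M
        ≡⟨ solveℕ 5 (λ a c x u M → (a ⊕ c) ⊕ (x ⊕ u) ⊗ M ⊜ (a ⊕ x ⊗ M) ⊕ (c ⊕ u ⊗ M)) refl a c x u M ⟩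
      (a ℕ.+ x ℕ.* M) ℕ.+ (c ℕ.+ u ℕ.* M)
        ≡⟨ cong₂ ℕ._+_ e f ⟩
      (b ℕ.+ y ℕ.* M) ℕ.+ (d ℕ.+ v ℕ.* M)
        ≡⟨ solveℕ 5 (λ b d y v M → (b ⊕ y ⊗ M) ⊕ (d ⊕ v ⊗ M) ⊜ (b ⊕ d) ⊕ (y ⊕ v) ⊗ M) refl b d y v M ⟩
      (b ℕ.+ d) ℕ.+ (y ℕ.+ v) ℕ.* M ∎)
    where open ≡-Reasoning

  Cg-cancel : ∀ {c a b} → Cg (c ℕ.+ a) (c ℕ.+ b) → Cg a b
  Cg-cancel {c} {a} {b} (x , y , e) = x , y ,
    NP.+-cancelˡ-≡ c _ _ (trans (sym (NP.+-assoc c a (x ℕ.* M))) (trans e (NP.+-assoc c b (y ℕ.* M))))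

  Cg-eq : ∀ {a b c d} → a ≡ c → b ≡ d → Cg a b → Cg c d
  Cg-eq refl refl g = g

  Cg0⇒∣ : ∀ {a} → Cg a 0 → M ∣ a
  Cg0⇒∣ {a} (x , y , e) = divides (y ∸ x) (begin
      a                           ≡⟨ sym (NP.m+n∸n≡m a (x ℕ.* M)) ⟩
      a ℕ.+ x ℕ.* M ∸ x ℕ.* M     ≡⟨ cong (_∸ x ℕ.* M) e ⟩
      y ℕ.* M ∸ x ℕ.* M           ≡⟨ sym (NP.*-distribʳ-∸ M y x) ⟩
      (y ∸ x) ℕ.* M               ∎)
    where open ≡-Reasoning

  congB-refl : ∀ a → congB a a M ≡ true
  congB-refl a = Cg→congB a a (Cg-refl a)

  congB-sym : ∀ a b → congB a b M ≡ congB b a M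
  congB-sym a b = congB-≡ a b b a Cg-sym Cg-sym

  Cg-addˡ : ∀ c {a b} → Cg a b → Cg (c ℕ.+ a) (c ℕ.+ b)
  Cg-addˡ c g = Cg-+ (Cg-refl c) g

  Cg-addʳ : ∀ c {a b} → Cg a b → Cg (a ℕ.+ c) (b ℕ.+ c)
  Cg-addʳ c g = Cg-+ g (Cg-refl c)

  reflect-class : ∀ c b → b ≤ c → congB (c ∸ b) c M ≡ congB b 0 M
  reflect-class c b le = congB-≡ (c ∸ b) c b 0 fw bw
    where
    x = c ∸ b
    xb : x ℕ.+ b ≡ c
    xb = NP.m∸n+n≡m le
    fw : Cg x c → Cg b 0
    fw g = Cg-sym (Cg-cancel {c = c} (Cg-eq (trans xb (sym (NP.+-identityʳ c))) refl (Cg-addʳ b g)))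
    bw : Cg b 0 → Cg x c
    bw g = Cg-sym (Cg-eq xb (NP.+-identityʳ x) (Cg-addˡ x g))

  shift-class : ∀ a b → congB a (a ℕ.+ b) M ≡ congB b 0 M
  shift-class a b = congB-≡ a (a ℕ.+ b) b 0 fw bw
    where
    fw : Cg a (a ℕ.+ b) → Cg b 0
    fw g = Cg-sym (Cg-cancel {c = a} (Cg-eq (sym (NP.+-identityʳ a)) refl g))
    bw : Cg b 0 → Cg a (a ℕ.+ b)
    bw g = Cg-eq (NP.+-identityʳ a) refl (Cg-addˡ a (Cg-sym g))

  mirror-class : ∀ c j → j ≤ c → congB (c ℕ.+ (c ∸ j)) c M ≡ congB j c M
  mirror-class c j le = congB-≡ (c ℕ.+ x) c j c fw bw
    where
    x = c ∸ j
    xj : x ℕ.+ j ≡ c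
    xj = NP.m∸n+n≡m le
    fw : Cg (c ℕ.+ x) c → Cg j c
    fw g = Cg-sym (Cg-cancel (Cg-eq (trans (NP.+-assoc c x j) (cong (c ℕ.+_) xj)) refl (Cg-addʳ j g)))
    bw : Cg j c → Cg (c ℕ.+ x) c
    bw g = Cg-cancel (Cg-eq (trans (cong (c ℕ.+_) (sym xj)) (trans (sym (NP.+-assoc c x j)) (NP.+-comm (c ℕ.+ x) j)))
                            (NP.+-comm c j) (Cg-addˡ c (Cg-sym g)))

  self-dual-class : ∀ c r → Cg (r ℕ.+ r) c → ∀ j → j ≤ c → congB (c ∸ j) r M ≡ congB j r M
  self-dual-class c r 2r≡c j le = congB-≡ (c ∸ j) r j r fw bw
    where
    x = c ∸ j
    xj : x ℕ.+ j ≡ c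
    xj = NP.m∸n+n≡m le
    fw : Cg x r → Cg j r
    fw g = Cg-sym (Cg-cancel {c = r} (Cg-trans 2r≡c (Cg-eq xj refl (Cg-addʳ j g))))
    bw : Cg j r → Cg x r
    bw g = Cg-sym (Cg-cancel {c = r} (Cg-trans 2r≡c (Cg-eq xj (NP.+-comm x r) (Cg-addˡ x g))))

  private
    sel≟-false : ∀ u r → u ≢ r → ⌊ u ℕ.≟ r ⌋ ≡ false
    sel≟-false u r ne with u ℕ.≟ r
    ... | yes e = ⊥-elim (ne e)
    ... | no _ = refl

    count-none : ∀ n u x → (∀ r → 0 < r → r ≤ n → u ≢ r) → ∑ n (λ r → sel ⌊ u ℕ.≟ r ⌋ x) ≡ 0ℚ
    count-none n u x h = trans (∑-cong n (λ r a b → cong (λ c → sel c x) (sel≟-false u r (h r a b)))) (∑-0 n)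

    count-one : ∀ n u x → 0 < u → u ≤ n → ∑ n (λ r → sel ⌊ u ℕ.≟ r ⌋ x) ≡ x
    count-one zero (suc u) x _ ()
    count-one (suc n) u x u>0 u≤ with u ℕ.≟ suc n
    ... | yes refl = trans (cong (ℚ._+ x) (count-none n (suc n) x (λ r _ r≤ e → NP.<-irrefl (sym e) (s≤s r≤))))
                           (QP.+-identityˡ x)
    ... | no ne = trans (QP.+-identityʳ _) (count-one n u x u>0 (NP.≤-pred (NP.≤∧≢⇒< u≤ ne)))

    -- The residue u < M is hit by exactly one r ∈ 1..M (namely r = u, or r = M for u = 0).
    count-residue : ∀ u x → u < M → ∑ m' (λ r → sel ⌊ u ℕ.≟ r ⌋ x) ℚ.+ sel ⌊ u ℕ.≟ 0 ⌋ x ≡ x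
    count-residue zero x _ = trans (cong (ℚ._+ x) (count-none m' 0 x (λ r r>0 _ e → NP.<-irrefl e r>0))) (QP.+-identityˡ x)
    count-residue (suc u) x (s≤s lt) = trans (QP.+-identityʳ _) (count-one m' (suc u) x (s≤s z≤n) lt)

  count : ∀ j x → ∑ M (λ r → sel (congB j r M) x) ≡ x
  count j x = begin
      ∑ m' (λ r → sel ⌊ j % M ℕ.≟ r % M ⌋ x) ℚ.+ sel ⌊ j % M ℕ.≟ M % M ⌋ x
        ≡⟨ cong₂ ℚ._+_ (∑-cong m' (λ r _ r≤ → cong (λ z → sel ⌊ j % M ℕ.≟ z ⌋ x) (m<n⇒m%n≡m (s≤s r≤))))
                       (cong (λ z → sel ⌊ j % M ℕ.≟ z ⌋ x) (n%n≡0 M)) ⟩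
      ∑ m' (λ r → sel ⌊ j % M ℕ.≟ r ⌋ x) ℚ.+ sel ⌊ j % M ℕ.≟ 0 ⌋ x
        ≡⟨ count-residue (j % M) x (m%n<n j M) ⟩
      x ∎
    where open ≡-Reasoning

  pairsum : ∀ j k x → ∑ M (λ r → sel (congB j r M) (sel (congB k r M) x)) ≡ sel (congB j k M) x
  pairsum j k x with congB j k M in ejk
  ... | true = trans (∑-ext M same-class) (count j x)
    where
    same-class : ∀ r → sel (congB j r M) (sel (congB k r M) x) ≡ sel (congB j r M) x
    same-class r = trans
      (cong (λ c → sel (congB j r M) (sel c x))
            (congB-≡ k r j r (Cg-trans (congB→Cg j k ejk)) (Cg-trans (Cg-sym (congB→Cg j k ejk)))))
      (sel-idem (congB j r M) x)
  ... | false = trans (∑-ext M different-classes) (∑-0 M)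
    where
    different-classes : ∀ r → sel (congB j r M) (sel (congB k r M) x) ≡ 0ℚ
    different-classes r with congB j r M in e1 | congB k r M in e2
    ... | false | _ = refl
    ... | true | false = refl
    ... | true | true with () ← trans (sym (Cg→congB j k (Cg-trans (congB→Cg j r e1) (Cg-sym (congB→Cg k r e2))))) ejk

-- p-integral rationals and congruences modulo powers of a prime p > 3

module PAdic (p : ℕ) (pr : Prime p) (p>3 : 3 < p) where

  open Casts
  open Sums
  open Selection using (sel)
  open import Data.Nat.Divisibility using (∣-trans; ∣1⇒≡1; ∣⇒≤; n∣m*n)
  open import Data.Nat.Coprimality as C using (coprime?; coprime-divisor)
  open import Relation.Nullary.Decidable using (recompute)

  den∣ : ∀ q u → toℚᵘ q U.≃ u → ↧ₙ q ∣ U.↧ₙ u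
  den∣ (ℚ.mkℚ n d c) (U.mkℚᵘ n' d') (U.*≡* eq) =
    coprime-divisor (C.sym (recompute (coprime? ℤ.∣ n ∣ (suc d)) c))
      (subst (suc d ∣_) (trans (sym (ZP.abs-* n' (+ suc d))) (trans (cong ℤ.∣_∣ (sym eq)) (ZP.abs-* n (+ suc d'))))
             (n∣m*n ℤ.∣ n' ∣))

  record I (q : ℚ) : Set where
    constructor mkI
    field unI : ¬ (p ∣ ↧ₙ q)
  open I public

  I-from : ∀ q u → toℚᵘ q U.≃ u → ¬ (p ∣ U.↧ₙ u) → I q
  I-from q u e np = mkI (λ pq → np (∣-trans pq (den∣ q u e)))

  p∤* : ∀ a b → ¬ (p ∣ a) → ¬ (p ∣ b) → ¬ (p ∣ a ℕ.* b)
  p∤* a b na nb h with euclidsLemma a b pr h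
  ... | inj₁ x = na x
  ... | inj₂ y = nb y

  I+ : ∀ {x y} → I x → I y → I (x ℚ.+ y)
  I+ {x@(ℚ.mkℚ _ _ _)} {y@(ℚ.mkℚ _ _ _)} ix iy = I-from (x ℚ.+ y) _ (QP.toℚᵘ-homo-+ x y) (p∤* _ _ (unI ix) (unI iy))

  I* : ∀ {x y} → I x → I y → I (x ℚ.* y)
  I* {x@(ℚ.mkℚ _ _ _)} {y@(ℚ.mkℚ _ _ _)} ix iy = I-from (x ℚ.* y) _ (QP.toℚᵘ-homo-* x y) (p∤* _ _ (unI ix) (unI iy))

  I- : ∀ {x} → I x → I (ℚ.- x)
  I- {x@(ℚ.mkℚ _ _ _)} ix = I-from (ℚ.- x) _ (QP.toℚᵘ-homo‿- x) (unI ix)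

  I-sub : ∀ {x y} → I x → I y → I (x ℚ.- y)
  I-sub ix iy = I+ ix (I- iy)

  I-ι : ∀ i → I (ι i)
  I-ι i = I-from (ι i) _ (toℚᵘ-/ i 0) (λ p∣1 → NP.>⇒≢ (NP.≤-trans (s≤s (s≤s z≤n)) p>3) (∣1⇒≡1 p∣1))

  I-n̂ : ∀ k → I (n̂ k)
  I-n̂ k = I-ι (+ k)

  I-0 : I 0ℚ
  I-0 = I-n̂ 0

  I-1 : I 1ℚ
  I-1 = I-n̂ 1

  I-inv : ∀ k → 0 < k → k < p → I (invℕ k)
  I-inv (suc k) _ lt = I-from _ _ (toℚᵘ-/ (+ 1) k) (λ p∣k → NP.<⇒≱ lt (∣⇒≤ p∣k))

  I-eq : ∀ {x y} → x ≡ y → I x → I y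
  I-eq refl i = i

  P : ℚ
  P = n̂ p

  Pow : ℕ → ℚ
  Pow zero = 1ℚ
  Pow (suc k) = P ℚ.* Pow k

  record D (k : ℕ) (z : ℚ) : Set where
    constructor mkD
    field
      wit : ℚ
      int : I wit
      eqn : z ≡ Pow k ℚ.* wit
  open D public

  D-+ : ∀ {k a b} → D k a → D k b → D k (a ℚ.+ b)
  D-+ {k} (mkD w₁ i₁ e₁) (mkD w₂ i₂ e₂) = mkD (w₁ ℚ.+ w₂) (I+ i₁ i₂)
    (trans (cong₂ ℚ._+_ e₁ e₂) (sym (QP.*-distribˡ-+ (Pow k) w₁ w₂)))

  D-neg : ∀ {k a} → D k a → D k (ℚ.- a)
  D-neg {k} (mkD w i e) = mkD (ℚ.- w) (I- i) (trans (cong ℚ.-_ e) (QP.neg-distribʳ-* (Pow k) w))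

  D-0 : ∀ {k} → D k 0ℚ
  D-0 {k} = mkD 0ℚ I-0 (sym (QP.*-zeroʳ (Pow k)))

  D-scale : ∀ {k c z} → I c → D k z → D k (c ℚ.* z)
  D-scale {k} {c} ic (mkD w i e) = mkD (c ℚ.* w) (I* ic i)
    (trans (cong (c ℚ.*_) e) (solve 3 (λ c a w → c :* (a :* w) := a :* (c :* w)) refl c (Pow k) w))

  D-P : ∀ {k z} → D k z → D (suc k) (P ℚ.* z)
  D-P {k} (mkD w i e) = mkD w i (trans (cong (P ℚ.*_) e) (sym (QP.*-assoc P (Pow k) w)))

  D-weak : ∀ {k z} → D (suc k) z → D k z
  D-weak {k} (mkD w i e) = mkD (P ℚ.* w) (I* (I-n̂ p) i)
    (trans e (solve 3 (λ a b c → (a :* b) :* c := b :* (a :* c)) refl P (Pow k) w))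

  D-eq : ∀ {k a b} → a ≡ b → D k a → D k b
  D-eq refl d = d

  D0⇒I : ∀ {z} → D 0 z → I z
  D0⇒I (mkD w i e) = I-eq (sym (trans e (QP.*-identityˡ w))) i

  I⇒D0 : ∀ {z} → I z → D 0 z
  I⇒D0 {z} i = mkD z i (sym (QP.*-identityˡ z))

  D1-intro : ∀ {z} w → I w → z ≡ P ℚ.* w → D 1 z
  D1-intro w i e = mkD w i (trans e (cong (ℚ._* w) (sym (QP.*-identityʳ P))))

  D-mul : ∀ {j k a b} → D j a → D k b → D (j ℕ.+ k) (a ℚ.* b)
  D-mul {zero} da db = D-scale (D0⇒I da) db
  D-mul {suc j} {k} {a} {b} (mkD w i e) db =
    D-eq (sym (trans (cong (ℚ._* b) e) (solve 4 (λ x y z u → ((x :* y) :* z) :* u := x :* ((y :* z) :* u)) refl P (Pow j) w b)))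
      (D-P (D-mul {j} {k} (mkD w i refl) db))

  infix 4 _≈[_]_
  record _≈[_]_ (x : ℚ) (k : ℕ) (y : ℚ) : Set where
    constructor ≈D
    field un≈ : D k (x ℚ.- y)
  open _≈[_]_ public

  ≈-refl : ∀ {k} x → x ≈[ k ] x
  ≈-refl x = ≈D (D-eq (sym (QP.+-inverseʳ x)) D-0)

  ≈-≡ : ∀ {k x y} → x ≡ y → x ≈[ k ] y
  ≈-≡ {x = x} refl = ≈-refl x

  ≈-sym : ∀ {k x y} → x ≈[ k ] y → y ≈[ k ] x
  ≈-sym {x = x} {y} d = ≈D (D-eq (solve 2 (λ x y → :- (x :- y) := y :- x) refl x y) (D-neg (un≈ d)))

  ≈-trans : ∀ {k x y z} → x ≈[ k ] y → y ≈[ k ] z → x ≈[ k ] z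
  ≈-trans {x = x} {y} {z} d e = ≈D (D-eq (solve 3 (λ x y z → (x :- y) :+ (y :- z) := x :- z) refl x y z) (D-+ (un≈ d) (un≈ e)))

  ≈-+ : ∀ {k x y u v} → x ≈[ k ] y → u ≈[ k ] v → (x ℚ.+ u) ≈[ k ] (y ℚ.+ v)
  ≈-+ {x = x} {y} {u} {v} d e =
    ≈D (D-eq (solve 4 (λ x y u v → (x :- y) :+ (u :- v) := (x :+ u) :- (y :+ v)) refl x y u v) (D-+ (un≈ d) (un≈ e)))

  ≈-neg : ∀ {k x y} → x ≈[ k ] y → (ℚ.- x) ≈[ k ] (ℚ.- y)
  ≈-neg {x = x} {y} d = ≈D (D-eq (solve 2 (λ x y → :- (x :- y) := (:- x) :- (:- y)) refl x y) (D-neg (un≈ d)))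

  ≈-scale : ∀ {k x y} c → I c → x ≈[ k ] y → (c ℚ.* x) ≈[ k ] (c ℚ.* y)
  ≈-scale {x = x} {y} c ic d = ≈D (D-eq (solve 3 (λ c x y → c :* (x :- y) := c :* x :- c :* y) refl c x y) (D-scale ic (un≈ d)))

  ≈-* : ∀ {k x y u v} → I u → I y → x ≈[ k ] y → u ≈[ k ] v → (x ℚ.* u) ≈[ k ] (y ℚ.* v)
  ≈-* {k} {x} {y} {u} {v} iu iy d e =
    ≈D (D-eq (solve 4 (λ x y u v → u :* (x :- y) :+ y :* (u :- v) := x :* u :- y :* v) refl x y u v)
      (D-+ (D-scale iu (un≈ d)) (D-scale iy (un≈ e))))

  ≈-weak : ∀ {k x y} → x ≈[ suc k ] y → x ≈[ k ] y
  ≈-weak d = ≈D (D-weak (un≈ d))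

  ≈-P : ∀ {k x y} → x ≈[ k ] y → (P ℚ.* x) ≈[ suc k ] (P ℚ.* y)
  ≈-P {x = x} {y} d = ≈D (D-eq (solve 3 (λ c x y → c :* (x :- y) := c :* x :- c :* y) refl P x y) (D-P (un≈ d)))

  P-inv : P ℚ.* invℕ p ≡ 1ℚ
  P-inv = trans (QP.*-comm P (invℕ p)) (invℕ-cancel p (NP.≤-trans (s≤s z≤n) p>3))

  ≈-divP : ∀ {k x y} c → I c → x ≈[ suc k ] y → (x ℚ.* (c ℚ.* invℕ p)) ≈[ k ] (y ℚ.* (c ℚ.* invℕ p))
  ≈-divP {k} {x} {y} c ic (≈D (mkD w i e)) = ≈D (mkD (w ℚ.* c) (I* i ic) quotient)
    where
    open ≡-Reasoning
    quotient : x ℚ.* (c ℚ.* invℕ p) ℚ.- y ℚ.* (c ℚ.* invℕ p) ≡ Pow k ℚ.* (w ℚ.* c)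
    quotient = begin
        x ℚ.* (c ℚ.* invℕ p) ℚ.- y ℚ.* (c ℚ.* invℕ p) ≡⟨ solve 4 (λ x y c i → x :* (c :* i) :- y :* (c :* i) := (x :- y) :* (c :* i))
                                                                 refl x y c (invℕ p) ⟩
        (x ℚ.- y) ℚ.* (c ℚ.* invℕ p)                   ≡⟨ cong (ℚ._* (c ℚ.* invℕ p)) e ⟩
        P ℚ.* Pow k ℚ.* w ℚ.* (c ℚ.* invℕ p)           ≡⟨ solve 5 (λ P q w c i → P :* q :* w :* (c :* i) := q :* (w :* c) :* (P :* i))
                                                                 refl P (Pow k) w c (invℕ p) ⟩
        Pow k ℚ.* (w ℚ.* c) ℚ.* (P ℚ.* invℕ p)         ≡⟨ cong (Pow k ℚ.* (w ℚ.* c) ℚ.*_) P-inv ⟩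
        Pow k ℚ.* (w ℚ.* c) ℚ.* 1ℚ                     ≡⟨ QP.*-identityʳ _ ⟩
        Pow k ℚ.* (w ℚ.* c)                            ∎

  module ≈-Reasoning {k : ℕ} where
    infix  3 _∎
    infixr 2 _≈⟨_⟩_ _≡⟨_⟩_
    infix  1 begin_
    begin_ : ∀ {x y} → x ≈[ k ] y → x ≈[ k ] y
    begin d = d
    _≈⟨_⟩_ : ∀ x {y z} → x ≈[ k ] y → y ≈[ k ] z → x ≈[ k ] z
    x ≈⟨ d ⟩ e = ≈-trans d e
    _≡⟨_⟩_ : ∀ x {y z} → x ≡ y → y ≈[ k ] z → x ≈[ k ] z
    x ≡⟨ refl ⟩ e = e
    _∎ : ∀ x → x ≈[ k ] x
    x ∎ = ≈-refl x

  ≈2⇒modsq : ∀ a b → a ≈[ 2 ] b → a ≡ b [modsq p ]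
  ≈2⇒modsq a b (≈D (mkD w i e)) = unI (I-eq (sym quotient) i)
    where
    p>0 : 0 < p
    p>0 = NP.≤-trans (s≤s z≤n) p>3
    quotient : (a ℚ.- b) ℚ.* invℕ (p ℕ.* p) ≡ w
    quotient = begin
        (a ℚ.- b) ℚ.* invℕ (p ℕ.* p)                ≡⟨ cong (ℚ._* invℕ (p ℕ.* p)) e ⟩
        (P ℚ.* (P ℚ.* 1ℚ) ℚ.* w) ℚ.* invℕ (p ℕ.* p)  ≡⟨ solve 3 (λ P w v → (P :* (P :* con 1ℚ) :* w) :* v := w :* (v :* (P :* P)))
                                                               refl P w (invℕ (p ℕ.* p)) ⟩
        w ℚ.* (invℕ (p ℕ.* p) ℚ.* (P ℚ.* P))         ≡⟨ cong (λ t → w ℚ.* (invℕ (p ℕ.* p) ℚ.* t)) (sym (n̂-* p p)) ⟩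
        w ℚ.* (invℕ (p ℕ.* p) ℚ.* n̂ (p ℕ.* p))       ≡⟨ cong (w ℚ.*_) (invℕ-cancel (p ℕ.* p) (NP.*-mono-≤ p>0 p>0)) ⟩
        w ℚ.* 1ℚ                                    ≡⟨ QP.*-identityʳ w ⟩
        w                                           ∎
      where open ≡-Reasoning

  ∑-I : ∀ n {f} → (∀ i → 0 < i → i ≤ n → I (f i)) → I (∑ n f)
  ∑-I zero h = I-0
  ∑-I (suc n) h = I+ (∑-I n (λ i a b → h i a (NP.m≤n⇒m≤1+n b))) (h (suc n) (s≤s z≤n) NP.≤-refl)

  ∑-≈ : ∀ {k} n {f g} → (∀ i → 0 < i → i ≤ n → f i ≈[ k ] g i) → ∑ n f ≈[ k ] ∑ n g
  ∑-≈ zero h = ≈-refl 0ℚ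
  ∑-≈ (suc n) h = ≈-+ (∑-≈ n (λ i a b → h i a (NP.m≤n⇒m≤1+n b))) (h (suc n) (s≤s z≤n) NP.≤-refl)

  AT-≈ : ∀ {k} n {f g} → (∀ a b → 0 < a → 0 < b → a ℕ.+ b ≤ n → f a b ≈[ k ] g a b) → AT n f ≈[ k ] AT n g
  AT-≈ n h = ∑-≈ n (λ a a>0 a≤n → ∑-≈ (n ∸ a) (λ b b>0 b≤ → h a b a>0 b>0 (AT-range a≤n b≤)))

  AT-I : ∀ n {f} → (∀ a b → 0 < a → 0 < b → a ℕ.+ b ≤ n → I (f a b)) → I (AT n f)
  AT-I n h = ∑-I n (λ a a>0 a≤n → ∑-I (n ∸ a) (λ b b>0 b≤ → h a b a>0 b>0 (AT-range a≤n b≤)))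

  sel-≈ : ∀ {k x y} b → x ≈[ k ] y → sel b x ≈[ k ] sel b y
  sel-≈ true d = d
  sel-≈ false d = ≈-refl 0ℚ

  sel-I : ∀ {x} b → I x → I (sel b x)
  sel-I true i = i
  sel-I false i = I-0

module SignedBinomial where

  open Casts
  open import Data.Nat.Combinatorics using (nCk+nC[k+1]≡[n+1]C[k+1]; nC1≡n)
  import Data.Nat.Solver as NS
  open NS.+-*-Solver using () renaming (solve to solveℕ; _:+_ to _⊕_; _:*_ to _⊗_; _:=_ to _⊜_; con to lit)

  absorb : ∀ n k → suc k ℕ.* (suc n C suc k) ≡ suc n ℕ.* (n C k)
  absorb zero zero = refl
  absorb zero (suc k) = NP.*-zeroʳ (suc (suc k))
  absorb (suc n) zero = trans (NP.+-identityʳ _) (trans (nC1≡n (suc (suc n))) (sym (NP.*-identityʳ (suc (suc n)))))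
  absorb (suc n) (suc k) = begin
      suc (suc k) ℕ.* (suc (suc n) C suc (suc k))
        ≡⟨ cong (suc (suc k) ℕ.*_) (sym (nCk+nC[k+1]≡[n+1]C[k+1] (suc n) (suc k))) ⟩
      suc (suc k) ℕ.* (a ℕ.+ b)
        ≡⟨ solveℕ 3 (λ k a b → (lit 2 ⊕ k) ⊗ (a ⊕ b) ⊜ ((lit 1 ⊕ k) ⊗ a ⊕ a) ⊕ (lit 2 ⊕ k) ⊗ b) refl k a b ⟩
      (suc k ℕ.* a ℕ.+ a) ℕ.+ suc (suc k) ℕ.* b
        ≡⟨ cong₂ (λ u v → (u ℕ.+ a) ℕ.+ v) (absorb n k) (absorb n (suc k)) ⟩
      (suc n ℕ.* (n C k) ℕ.+ a) ℕ.+ suc n ℕ.* (n C suc k)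
        ≡⟨ solveℕ 4 (λ n x y a → ((lit 1 ⊕ n) ⊗ x ⊕ a) ⊕ (lit 1 ⊕ n) ⊗ y ⊜ (lit 1 ⊕ n) ⊗ (x ⊕ y) ⊕ a) refl n (n C k) (n C suc k) a ⟩
      suc n ℕ.* (n C k ℕ.+ n C suc k) ℕ.+ a
        ≡⟨ cong (λ z → suc n ℕ.* z ℕ.+ a) (nCk+nC[k+1]≡[n+1]C[k+1] n k) ⟩
      suc n ℕ.* a ℕ.+ a
        ≡⟨ solveℕ 2 (λ n a → (lit 1 ⊕ n) ⊗ a ⊕ a ⊜ (lit 2 ⊕ n) ⊗ a) refl n a ⟩
      suc (suc n) ℕ.* a ∎
    where
    open ≡-Reasoning
    a = suc n C suc k
    b = suc n C suc (suc k)

  sgn-suc : ∀ k → sgn (suc k) ≡ ℤ.- sgn k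
  sgn-suc zero = refl
  sgn-suc (suc k) = trans (sym (ZP.neg-involutive (sgn k))) (cong ℤ.-_ (sym (sgn-suc k)))

  sgn-even : ∀ j k → sgn (j ℕ.+ (j ℕ.+ k)) ≡ sgn k
  sgn-even zero k = refl
  sgn-even (suc j) k = trans (cong sgn (cong suc (NP.+-suc j (j ℕ.+ k)))) (sgn-even j k)

  private
    *-swap : ∀ a b c → a ℤ.* (b ℤ.* c) ≡ b ℤ.* (a ℤ.* c)
    *-swap a b c = trans (sym (ZP.*-assoc a b c)) (trans (cong (ℤ._* c) (ZP.*-comm a b)) (ZP.*-assoc b a c))

  module _ (n : ℕ) where

    Q : ℕ → ℚ
    Q k = ι (sgn k ℤ.* + (n C k))

    t : ℕ → ℚ
    t k = ι (sgn k ℤ.* + (suc n C k))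

    t-pascal : ∀ k → t (suc k) ≡ Q (suc k) ℚ.- Q k
    t-pascal k = begin
        ι (s ℤ.* + (suc n C suc k))                    ≡⟨ cong (λ z → ι (s ℤ.* + z)) (sym (nCk+nC[k+1]≡[n+1]C[k+1] n k)) ⟩
        ι (s ℤ.* + (n C k ℕ.+ n C suc k))              ≡⟨ cong (λ z → ι (s ℤ.* z)) (ZP.pos-+ (n C k) (n C suc k)) ⟩
        ι (s ℤ.* (+ (n C k) ℤ.+ + (n C suc k)))        ≡⟨ cong ι (ZP.*-distribˡ-+ s (+ (n C k)) (+ (n C suc k))) ⟩
        ι (s ℤ.* + (n C k) ℤ.+ s ℤ.* + (n C suc k))    ≡⟨ ι-+ (s ℤ.* + (n C k)) (s ℤ.* + (n C suc k)) ⟩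
        ι (s ℤ.* + (n C k)) ℚ.+ Q (suc k)              ≡⟨ cong (λ z → ι (z ℤ.* + (n C k)) ℚ.+ Q (suc k)) (sgn-suc k) ⟩
        ι (ℤ.- sgn k ℤ.* + (n C k)) ℚ.+ Q (suc k)      ≡⟨ cong (λ z → ι z ℚ.+ Q (suc k)) (sym (ZP.neg-distribˡ-* (sgn k) (+ (n C k)))) ⟩
        ι (ℤ.- (sgn k ℤ.* + (n C k))) ℚ.+ Q (suc k)    ≡⟨ cong (ℚ._+ Q (suc k)) (ι-neg (sgn k ℤ.* + (n C k))) ⟩
        ℚ.- Q k ℚ.+ Q (suc k)                          ≡⟨ QP.+-comm (ℚ.- Q k) (Q (suc k)) ⟩
        Q (suc k) ℚ.- Q k                              ∎
      where
      open ≡-Reasoning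
      s = sgn (suc k)

    t-absorb : ∀ k → n̂ (suc k) ℚ.* t (suc k) ≡ ℚ.- (n̂ (suc n) ℚ.* Q k)
    t-absorb k = begin
        n̂ (suc k) ℚ.* ι (s ℤ.* + (suc n C suc k))     ≡⟨ sym (ι-* (+ suc k) (s ℤ.* + (suc n C suc k))) ⟩
        ι (+ suc k ℤ.* (s ℤ.* + (suc n C suc k)))      ≡⟨ cong ι (*-swap (+ suc k) s _) ⟩
        ι (s ℤ.* (+ suc k ℤ.* + (suc n C suc k)))      ≡⟨ cong (λ z → ι (s ℤ.* z)) (sym (ZP.pos-* (suc k) _)) ⟩
        ι (s ℤ.* + (suc k ℕ.* (suc n C suc k)))        ≡⟨ cong (λ z → ι (s ℤ.* + z)) (absorb n k) ⟩
        ι (s ℤ.* + (suc n ℕ.* (n C k)))                ≡⟨ cong (λ z → ι (z ℤ.* + (suc n ℕ.* (n C k)))) (sgn-suc k) ⟩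
        ι (ℤ.- sgn k ℤ.* + (suc n ℕ.* (n C k)))        ≡⟨ cong ι (sym (ZP.neg-distribˡ-* (sgn k) _)) ⟩
        ι (ℤ.- (sgn k ℤ.* + (suc n ℕ.* (n C k))))      ≡⟨ ι-neg (sgn k ℤ.* + (suc n ℕ.* (n C k))) ⟩
        ℚ.- ι (sgn k ℤ.* + (suc n ℕ.* (n C k)))        ≡⟨ cong (λ z → ℚ.- ι (sgn k ℤ.* z)) (ZP.pos-* (suc n) (n C k)) ⟩
        ℚ.- ι (sgn k ℤ.* (+ suc n ℤ.* + (n C k)))      ≡⟨ cong (λ z → ℚ.- ι z) (*-swap (sgn k) (+ suc n) _) ⟩
        ℚ.- ι (+ suc n ℤ.* (sgn k ℤ.* + (n C k)))      ≡⟨ cong ℚ.-_ (ι-* (+ suc n) (sgn k ℤ.* + (n C k))) ⟩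
        ℚ.- (n̂ (suc n) ℚ.* Q k)                        ∎
      where
      open ≡-Reasoning
      s = sgn (suc k)

module Wolstenholme (h : ℕ) (pr : Prime (suc (h ℕ.+ h))) (p>3 : 3 < suc (h ℕ.+ h)) where

  open Casts
  open Sums
  import Data.Nat.Solver as NS
  open NS.+-*-Solver using () renaming (solve to solveℕ; _:+_ to _⊕_; _:=_ to _⊜_; con to lit)

  p : ℕ
  p = suc (h ℕ.+ h)

  N : ℕ
  N = h ℕ.+ h

  open PAdic p pr p>3 public

  I-invN : ∀ k → 0 < k → k ≤ N → I (invℕ k)
  I-invN k pos le = I-inv k pos (s≤s le)

  p∸-pos : ∀ x → x ≤ N → 0 < p ∸ x
  p∸-pos x le = NP.m<n⇒0<n∸m (s≤s le)

  p∸-le : ∀ x → 0 < x → p ∸ x ≤ N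
  p∸-le (suc x) _ = NP.m∸n≤m N x

  I-inv-p∸ : ∀ x → 0 < x → x ≤ N → I (invℕ (p ∸ x))
  I-inv-p∸ x pos le = I-invN (p ∸ x) (p∸-pos x le) (p∸-le x pos)

  I-inv2 : I (invℕ 2)
  I-inv2 = I-inv 2 (s≤s z≤n) (NP.<-trans (s≤s (s≤s (s≤s z≤n))) p>3)

  I-inv3 : I (invℕ 3)
  I-inv3 = I-inv 3 (s≤s z≤n) p>3

  inv-reflect-sum : ∀ x → 0 < x → x ≤ N → invℕ (p ∸ x) ℚ.+ invℕ x ≡ P ℚ.* (invℕ x ℚ.* invℕ (p ∸ x))
  inv-reflect-sum x pos le = begin
      v ℚ.+ u                             ≡⟨ sym (cong₂ ℚ._+_ (trans (cong (v ℚ.*_) ua) (QP.*-identityʳ v))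
                                                           (trans (cong (u ℚ.*_) vb) (QP.*-identityʳ u))) ⟩
      v ℚ.* (u ℚ.* a) ℚ.+ u ℚ.* (v ℚ.* b) ≡⟨ solve 4 (λ u v a b → v :* (u :* a) :+ u :* (v :* b) := (a :+ b) :* (u :* v)) refl u v a b ⟩
      (a ℚ.+ b) ℚ.* (u ℚ.* v)              ≡⟨ cong (ℚ._* (u ℚ.* v)) (trans (sym (n̂-+ x (p ∸ x)))
                                                                        (cong n̂ (NP.m+[n∸m]≡n (NP.m≤n⇒m≤1+n le)))) ⟩
      P ℚ.* (u ℚ.* v)                      ∎
    where
    open ≡-Reasoning
    u = invℕ x
    v = invℕ (p ∸ x)
    a = n̂ x
    b = n̂ (p ∸ x)
    ua : u ℚ.* a ≡ 1ℚ
    ua = invℕ-cancel x pos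
    vb : v ℚ.* b ≡ 1ℚ
    vb = invℕ-cancel (p ∸ x) (p∸-pos x le)

  inv-reflect : ∀ x → 0 < x → x ≤ N → invℕ (p ∸ x) ≈[ 1 ] ℚ.- invℕ x
  inv-reflect x pos le = ≈D (D1-intro (invℕ x ℚ.* invℕ (p ∸ x)) (I* (I-invN x pos le) (I-inv-p∸ x pos le))
    (trans (solve 2 (λ v u → v :- (:- u) := v :+ u) refl (invℕ (p ∸ x)) (invℕ x)) (inv-reflect-sum x pos le)))

  sq : ℕ → ℚ
  sq k = invℕ k ℚ.* invℕ k

  sq-reflect : ∀ x → 0 < x → x ≤ N → sq (p ∸ x) ≈[ 1 ] sq x
  sq-reflect x pos le = ≈-trans (≈-* (I-inv-p∸ x pos le) (I- (I-invN x pos le)) (inv-reflect x pos le) (inv-reflect x pos le))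
    (≈-≡ (solve 1 (λ u → (:- u) :* (:- u) := u :* u) refl (invℕ x)))

  -- Halving is allowed modulo odd prime powers.
  inv2-cancel : ∀ x → invℕ 2 ℚ.* (x ℚ.+ x) ≡ x
  inv2-cancel x = trans (solve 2 (λ a x → a :* (x :+ x) := (a :* (con 1ℚ :+ con 1ℚ)) :* x) refl (invℕ 2) x)
    (QP.*-identityˡ x)

  half : ∀ {k x} → (x ℚ.+ x) ≈[ k ] 0ℚ → x ≈[ k ] 0ℚ
  half {k} {x} d = ≈-trans (≈-≡ (sym (inv2-cancel x)))
    (≈-trans (≈-scale (invℕ 2) I-inv2 d) (≈-≡ (QP.*-zeroʳ (invℕ 2))))

  sqSum : ℚ
  sqSum = ∑ N sq

  sqSumLow : ℚ
  sqSumLow = ∑ h sq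

  -- Pairing k with p-k: Σ_{k≤N} 1/k² ≡ 2 Σ_{k≤h} 1/k² (mod p).
  sqSum≈twice : sqSum ≈[ 1 ] sqSumLow ℚ.+ sqSumLow
  sqSum≈twice = begin
      ∑ (h ℕ.+ h) sq                                    ≡⟨ ∑-split h h sq ⟩
      sqSumLow ℚ.+ ∑ h (λ i → sq (h ℕ.+ i))             ≡⟨ cong (sqSumLow ℚ.+_) (∑-rev h _) ⟩
      sqSumLow ℚ.+ ∑ h (λ i → sq (h ℕ.+ (suc h ∸ i)))   ≡⟨ cong (sqSumLow ℚ.+_) (∑-cong h (λ i _ le → cong sq (upper i le))) ⟩
      sqSumLow ℚ.+ ∑ h (λ i → sq (p ∸ i))
        ≈⟨ ≈-+ (≈-refl sqSumLow) (∑-≈ h (λ i pos le → sq-reflect i pos (NP.≤-trans le (NP.m≤m+n h h)))) ⟩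
      sqSumLow ℚ.+ sqSumLow                             ∎
    where
    open ≈-Reasoning
    upper : ∀ i → i ≤ h → h ℕ.+ (suc h ∸ i) ≡ p ∸ i
    upper i le = trans (sym (NP.+-∸-assoc h (NP.m≤n⇒m≤1+n le))) (cong (_∸ i) (NP.+-suc h h))

  quarter : ℚ
  quarter = invℕ 2 ℚ.* invℕ 2

  odd-reflect : ∀ i → 0 < i → i ≤ h → (suc h ∸ i) ℕ.+ (suc h ∸ i) ∸ 1 ≡ p ∸ (i ℕ.+ i)
  odd-reflect i pos le = begin
      (suc h ∸ i) ℕ.+ (suc h ∸ i) ∸ 1          ≡⟨ cong (λ z → z ℕ.+ z ∸ 1) (NP.+-∸-assoc 1 le) ⟩
      j ℕ.+ suc j                              ≡⟨ NP.+-suc j j ⟩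
      suc (j ℕ.+ j)                            ≡⟨ sym (NP.m+n∸m≡n (i ℕ.+ i) (suc (j ℕ.+ j))) ⟩
      (i ℕ.+ i) ℕ.+ suc (j ℕ.+ j) ∸ (i ℕ.+ i)  ≡⟨ cong (_∸ (i ℕ.+ i)) sum≡p ⟩
      p ∸ (i ℕ.+ i)                            ∎
    where
    open ≡-Reasoning
    j = h ∸ i
    sum≡p : (i ℕ.+ i) ℕ.+ suc (j ℕ.+ j) ≡ p
    sum≡p = trans (solveℕ 2 (λ i j → (i ⊕ i) ⊕ (lit 1 ⊕ (j ⊕ j)) ⊜ lit 1 ⊕ ((i ⊕ j) ⊕ (i ⊕ j))) refl i j)
                  (cong (λ z → suc (z ℕ.+ z)) (NP.m+[n∸m]≡n le))

  sq-double : ∀ i → 0 < i → sq (i ℕ.+ i) ≡ quarter ℚ.* sq i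
  sq-double i pos = trans (cong (λ z → invℕ z ℚ.* invℕ z) (cong (i ℕ.+_) (sym (NP.+-identityʳ i))))
    (trans (cong (λ z → z ℚ.* z) (invℕ-* 2 i (s≤s z≤n) pos))
    (solve 2 (λ a b → (a :* b) :* (a :* b) := (a :* a) :* (b :* b)) refl (invℕ 2) (invℕ i)))

  -- Pairing 2i-1 with 2i and reflecting the odd terms: Σ_{k≤N} 1/k² ≡ (1/2) Σ_{k≤h} 1/k² (mod p).
  sqSum≈half : sqSum ≈[ 1 ] (quarter ℚ.+ quarter) ℚ.* sqSumLow
  sqSum≈half = begin
      ∑ (h ℕ.+ h) sq
        ≡⟨ trans (∑-pair h sq) (∑-+ h _ _) ⟩
      ∑ h (λ i → sq (i ℕ.+ i ∸ 1)) ℚ.+ ∑ h evens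
        ≡⟨ cong (ℚ._+ ∑ h evens) (trans (∑-rev h _) (∑-cong h (λ i pos le → cong sq (odd-reflect i pos le)))) ⟩
      ∑ h (λ i → sq (p ∸ (i ℕ.+ i))) ℚ.+ ∑ h evens
        ≈⟨ ≈-+ (∑-≈ h (λ i pos le → sq-reflect (i ℕ.+ i) (NP.≤-trans pos (NP.m≤m+n i i)) (NP.+-mono-≤ le le))) (≈-refl _) ⟩
      ∑ h evens ℚ.+ ∑ h evens
        ≡⟨ cong (λ z → z ℚ.+ z) (trans (∑-cong h (λ i pos _ → sq-double i pos)) (∑-* h quarter sq)) ⟩
      quarter ℚ.* sqSumLow ℚ.+ quarter ℚ.* sqSumLow
        ≡⟨ sym (QP.*-distribʳ-+ sqSumLow quarter quarter) ⟩
      (quarter ℚ.+ quarter) ℚ.* sqSumLow ∎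
    where
    open ≈-Reasoning
    evens : ℕ → ℚ
    evens i = sq (i ℕ.+ i)

  -- Comparing the two: (2 - 1/2)·Σ_{k≤h} 1/k² ≡ 0, and 3/2 is a unit since p > 3.
  sqSumLow≈0 : sqSumLow ≈[ 1 ] 0ℚ
  sqSumLow≈0 = ≈D (D-eq cancel (D-scale (I* I-inv3 (I+ I-1 I-1)) (un≈ (≈-trans (≈-sym sqSum≈twice) sqSum≈half))))
    where
    cancel : (invℕ 3 ℚ.* (1ℚ ℚ.+ 1ℚ)) ℚ.* ((sqSumLow ℚ.+ sqSumLow) ℚ.- (quarter ℚ.+ quarter) ℚ.* sqSumLow) ≡ sqSumLow ℚ.- 0ℚ
    cancel = solve 1 (λ s → (con (invℕ 3) :* (con 1ℚ :+ con 1ℚ)) :* ((s :+ s) :- (con quarter :+ con quarter) :* s) := s :- con 0ℚ)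
                     refl sqSumLow

  sqSum≈0 : sqSum ≈[ 1 ] 0ℚ
  sqSum≈0 = ≈-trans sqSum≈twice (≈-trans (≈-+ sqSumLow≈0 sqSumLow≈0) (≈-≡ (QP.+-identityʳ 0ℚ)))

  harmonic : ℕ → ℚ
  harmonic n = ∑ n invℕ

  I-harmonic : ∀ k → k ≤ N → I (harmonic k)
  I-harmonic k le = ∑-I k (λ i pos i≤ → I-invN i pos (NP.≤-trans i≤ le))

  -- Wolstenholme: 2H_N = Σ_k (1/k + 1/(p-k)) = p Σ_k 1/(k(p-k)) ≡ -p Σ_k 1/k² ≡ 0 (mod p²).
  wolstenholme : harmonic N ≈[ 2 ] 0ℚ
  wolstenholme = half (≈D (D-eq (sym twice≡) (D-P (un≈ cross≈0))))
    where
    cross : ℚ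
    cross = ∑ N (λ k → invℕ k ℚ.* invℕ (p ∸ k))
    cross≈0 : cross ≈[ 1 ] 0ℚ
    cross≈0 = ≈-trans (∑-≈ N (λ k pos le → ≈-* (I-inv-p∸ k pos le) (I-invN k pos le) (≈-refl (invℕ k)) (inv-reflect k pos le)))
              (≈-trans (≈-≡ (trans (∑-ext N (λ k → sym (QP.neg-distribʳ-* (invℕ k) (invℕ k)))) (∑-neg N sq)))
                       (≈-neg sqSum≈0))
    twice≡ : (harmonic N ℚ.+ harmonic N) ℚ.- 0ℚ ≡ P ℚ.* (cross ℚ.- 0ℚ)
    twice≡ = begin
        (harmonic N ℚ.+ harmonic N) ℚ.- 0ℚ        ≡⟨ QP.+-identityʳ _ ⟩
        harmonic N ℚ.+ harmonic N                 ≡⟨ cong (harmonic N ℚ.+_) (∑-rev N invℕ) ⟩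
        harmonic N ℚ.+ ∑ N (λ k → invℕ (p ∸ k))   ≡⟨ sym (∑-+ N invℕ (λ k → invℕ (p ∸ k))) ⟩
        ∑ N (λ k → invℕ k ℚ.+ invℕ (p ∸ k))       ≡⟨ ∑-cong N (λ k pos le → trans (QP.+-comm (invℕ k) (invℕ (p ∸ k)))
                                                                              (inv-reflect-sum k pos le)) ⟩
        ∑ N (λ k → P ℚ.* (invℕ k ℚ.* invℕ (p ∸ k))) ≡⟨ ∑-* N P _ ⟩
        P ℚ.* cross                               ≡⟨ cong (P ℚ.*_) (sym (QP.+-identityʳ cross)) ⟩
        P ℚ.* (cross ℚ.- 0ℚ)                      ∎
      where open ≡-Reasoning

  -- The second elementary symmetric function e₂(n) = Σ_{1≤j<k≤n} 1/(jk) = Σ_{k≤n} H_{k-1}/k.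
  e₂ : ℕ → ℚ
  e₂ n = ∑ n (λ j → harmonic (j ∸ 1) ℚ.* invℕ j)

  I-e₂ : ∀ k → k ≤ N → I (e₂ k)
  I-e₂ k le = ∑-I k (λ i pos i≤ → I* (I-harmonic (i ∸ 1) (NP.≤-trans (NP.m∸n≤m i 1) (NP.≤-trans i≤ le)))
                                      (I-invN i pos (NP.≤-trans i≤ le)))

  e₂-Tri : ∀ n → Tri n (λ j k → invℕ j ℚ.* invℕ k) ≡ e₂ n
  e₂-Tri n = ∑-ext n (λ k → ∑-*ʳ (k ∸ 1) (invℕ k) invℕ)

  -- 2e₂(N) = H_N² - Σ 1/k² ≡ 0 (mod p).
  e₂≈0 : e₂ N ≈[ 1 ] 0ℚ
  e₂≈0 = half (≈-trans (≈-≡ twice≡) (≈-trans (≈-+ H²≈0 (≈-neg sqSum≈0)) (≈-≡ refl)))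
    where
    H²≈0 : (harmonic N ℚ.* harmonic N) ≈[ 1 ] 0ℚ
    H²≈0 = ≈-weak (≈-weak (≈-weak (≈D (D-eq (solve 1 (λ x → (x :- con 0ℚ) :* (x :- con 0ℚ) := x :* x :- con 0ℚ) refl (harmonic N))
                                              (D-mul (un≈ wolstenholme) (un≈ wolstenholme))))))
    prod : ℕ → ℕ → ℚ
    prod j k = invℕ j ℚ.* invℕ k
    twice≡ : e₂ N ℚ.+ e₂ N ≡ harmonic N ℚ.* harmonic N ℚ.+ ℚ.- sqSum
    twice≡ = begin
        e₂ N ℚ.+ e₂ N                                  ≡⟨ cong₂ ℚ._+_ (sym (e₂-Tri N)) (sym (e₂-Tri N)) ⟩
        Tri N prod ℚ.+ Tri N prod                      ≡⟨ sym (Tri-+ N _ _) ⟩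
        Tri N (λ j k → prod j k ℚ.+ prod j k)          ≡⟨ Tri-ext N (λ j k → cong (prod j k ℚ.+_) (QP.*-comm (invℕ j) (invℕ k))) ⟩
        Tri N (λ j k → prod j k ℚ.+ prod k j)          ≡⟨ solve 2 (λ a b → a := (b :+ a) :- b) refl _ sqSum ⟩
        (sqSum ℚ.+ Tri N (λ j k → prod j k ℚ.+ prod k j)) ℚ.- sqSum ≡⟨ cong (ℚ._- sqSum) (sym (Sq-Tri N prod)) ⟩
        Sq N prod ℚ.- sqSum                            ≡⟨ cong (ℚ._- sqSum) (sym (∑-mul N N invℕ invℕ)) ⟩
        harmonic N ℚ.* harmonic N ℚ.+ ℚ.- sqSum        ∎
      where open ≡-Reasoning

-- The binomial coefficients C(2p-1, k) and C(2p, k) modulo p³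

module BinomialExpansion (h : ℕ) (pr : Prime (suc (h ℕ.+ h))) (p>3 : 3 < suc (h ℕ.+ h)) where

  open Casts
  open Wolstenholme h pr p>3
  open SignedBinomial
  open import Data.Nat.Combinatorics using (nCk≡nC[n∸k])

  M₁ : ℕ
  M₁ = N ℕ.+ p

  Q₁ : ℕ → ℚ
  Q₁ = Q M₁

  t₁ : ℕ → ℚ
  t₁ = t M₁

  A : ℚ
  A = P ℚ.+ P

  I-A : I A
  I-A = I+ (I-n̂ p) (I-n̂ p)

  t₁-absorb : ∀ k → t₁ (suc k) ≡ ℚ.- (invℕ (suc k) ℚ.* (A ℚ.* Q₁ k))
  t₁-absorb k = begin
      t₁ (suc k)                                        ≡⟨ sym (QP.*-identityˡ _) ⟩
      1ℚ ℚ.* t₁ (suc k)                                 ≡⟨ cong (ℚ._* t₁ (suc k)) (sym (invℕ-cancel (suc k) (s≤s z≤n))) ⟩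
      (invℕ (suc k) ℚ.* n̂ (suc k)) ℚ.* t₁ (suc k)       ≡⟨ QP.*-assoc (invℕ (suc k)) (n̂ (suc k)) (t₁ (suc k)) ⟩
      invℕ (suc k) ℚ.* (n̂ (suc k) ℚ.* t₁ (suc k))       ≡⟨ cong (invℕ (suc k) ℚ.*_) (t-absorb M₁ k) ⟩
      invℕ (suc k) ℚ.* ℚ.- (n̂ (suc M₁) ℚ.* Q₁ k)        ≡⟨ cong (λ z → invℕ (suc k) ℚ.* ℚ.- (z ℚ.* Q₁ k)) (n̂-+ p p) ⟩
      invℕ (suc k) ℚ.* ℚ.- (A ℚ.* Q₁ k)                 ≡⟨ sym (QP.neg-distribʳ-* (invℕ (suc k)) (A ℚ.* Q₁ k)) ⟩
      ℚ.- (invℕ (suc k) ℚ.* (A ℚ.* Q₁ k))               ∎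
    where open ≡-Reasoning

  -- Q₁ (k+1) = (1 - A/(k+1))·Q₁ k, so Q₁ k = Π_{i≤k} (1 - 2p/i).
  Q₁-step : ∀ k → Q₁ (suc k) ≡ (1ℚ ℚ.- invℕ (suc k) ℚ.* A) ℚ.* Q₁ k
  Q₁-step k = begin
      Q₁ (suc k)                                   ≡⟨ solve 2 (λ a b → a := (a :- b) :+ b) refl (Q₁ (suc k)) (Q₁ k) ⟩
      (Q₁ (suc k) ℚ.- Q₁ k) ℚ.+ Q₁ k               ≡⟨ cong (ℚ._+ Q₁ k) (sym (t-pascal M₁ k)) ⟩
      t₁ (suc k) ℚ.+ Q₁ k                          ≡⟨ cong (ℚ._+ Q₁ k) (t₁-absorb k) ⟩
      ℚ.- (invℕ (suc k) ℚ.* (A ℚ.* Q₁ k)) ℚ.+ Q₁ k ≡⟨ solve 3 (λ i a q → :- (i :* (a :* q)) :+ q := (con 1ℚ :- i :* a) :* q)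
                                                            refl (invℕ (suc k)) A (Q₁ k) ⟩
      (1ℚ ℚ.- invℕ (suc k) ℚ.* A) ℚ.* Q₁ k         ∎
    where open ≡-Reasoning

  -- The third-order truncation of Π_{i≤k} (1 - A/i).
  Q₁-approx : ℕ → ℚ
  Q₁-approx k = 1ℚ ℚ.- A ℚ.* harmonic k ℚ.+ A ℚ.* A ℚ.* e₂ k

  -- Multiplying the truncation by (1 - A/(k+1)) errs by -8p³ e₂(k)/(k+1).
  step-error : ℕ → ℚ
  step-error k = ℚ.- (eight ℚ.* (invℕ (suc k) ℚ.* e₂ k))
    where eight = (1ℚ ℚ.+ 1ℚ) ℚ.* (1ℚ ℚ.+ 1ℚ) ℚ.* (1ℚ ℚ.+ 1ℚ)

  I-step-error : ∀ k → suc k ≤ N → I (step-error k)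
  I-step-error k le = I- (I* (I* (I* two two) two) (I* (I-invN (suc k) (s≤s z≤n) le) (I-e₂ k (NP.≤-trans (NP.n≤1+n k) le))))
    where two = I+ I-1 I-1

  Q₁-expansion : ∀ k → k ≤ N → Q₁ k ≈[ 3 ] Q₁-approx k
  Q₁-expansion zero _ = ≈-≡ (solve 1 (λ a → con 1ℚ := con 1ℚ :- a :* con 0ℚ :+ a :* a :* con 0ℚ) refl A)
  Q₁-expansion (suc k) le =
    ≈-trans (≈-≡ (Q₁-step k))
    (≈-trans (≈-scale c (I-sub I-1 (I* (I-invN (suc k) (s≤s z≤n) le) I-A)) (Q₁-expansion k (NP.≤-trans (NP.n≤1+n k) le)))
             (≈D (mkD (step-error k) (I-step-error k le) error≡)))
    where
    c = 1ℚ ℚ.- invℕ (suc k) ℚ.* A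
    error≡ : c ℚ.* Q₁-approx k ℚ.- Q₁-approx (suc k) ≡ Pow 3 ℚ.* step-error k
    error≡ = solve 4 (λ P i h e → (con 1ℚ :- i :* (P :+ P)) :* (con 1ℚ :- (P :+ P) :* h :+ (P :+ P) :* (P :+ P) :* e)
                                   :- (con 1ℚ :- (P :+ P) :* (h :+ i) :+ (P :+ P) :* (P :+ P) :* (e :+ h :* i))
                                 := P :* (P :* (P :* con 1ℚ)) :* (:- (((con 1ℚ :+ con 1ℚ) :* (con 1ℚ :+ con 1ℚ) :* (con 1ℚ :+ con 1ℚ)) :* (i :* e))))
               refl P (invℕ (suc k)) (harmonic k) (e₂ k)

  t₁-expansion : ∀ k → suc k ≤ N →
    t₁ (suc k) ≈[ 3 ] ℚ.- (A ℚ.* invℕ (suc k)) ℚ.+ A ℚ.* A ℚ.* (harmonic k ℚ.* invℕ (suc k))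
  t₁-expansion k le =
    ≈-trans (≈-≡ (trans (t₁-absorb k) (solve 3 (λ i a q → :- (i :* (a :* q)) := (:- (i :* a)) :* q) refl (invℕ (suc k)) A (Q₁ k))))
    (≈-trans (≈-scale c (I- (I* (I-invN (suc k) (s≤s z≤n) le) I-A)) (Q₁-expansion k (NP.≤-trans (NP.n≤1+n k) le)))
             (≈D (mkD (step-error k) (I-step-error k le) error≡)))
    where
    c = ℚ.- (invℕ (suc k) ℚ.* A)
    error≡ : c ℚ.* Q₁-approx k ℚ.- (ℚ.- (A ℚ.* invℕ (suc k)) ℚ.+ A ℚ.* A ℚ.* (harmonic k ℚ.* invℕ (suc k))) ≡ Pow 3 ℚ.* step-error k
    error≡ = solve 4 (λ P i h e → (:- (i :* (P :+ P))) :* (con 1ℚ :- (P :+ P) :* h :+ (P :+ P) :* (P :+ P) :* e)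
                                   :- (:- ((P :+ P) :* i) :+ (P :+ P) :* (P :+ P) :* (h :* i))
                                 := P :* (P :* (P :* con 1ℚ)) :* (:- (((con 1ℚ :+ con 1ℚ) :* (con 1ℚ :+ con 1ℚ) :* (con 1ℚ :+ con 1ℚ)) :* (i :* e))))
               refl P (invℕ (suc k)) (harmonic k) (e₂ k)

  -- By Wolstenholme and e₂(N) ≡ 0: C(2p-1, p-1) ≡ 1 (mod p³).
  Q₁-N≈1 : Q₁ N ≈[ 3 ] 1ℚ
  Q₁-N≈1 = ≈-trans (Q₁-expansion N NP.≤-refl) (≈D (D-eq approx-1≡ (D-+ (D-neg d1) d2)))
    where
    two = 1ℚ ℚ.+ 1ℚ
    I2 = I+ I-1 I-1
    d1 : D 3 (two ℚ.* (P ℚ.* (harmonic N ℚ.- 0ℚ)))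
    d1 = D-scale I2 (D-P (un≈ wolstenholme))
    d2 : D 3 (two ℚ.* (two ℚ.* (P ℚ.* (P ℚ.* (e₂ N ℚ.- 0ℚ)))))
    d2 = D-scale I2 (D-scale I2 (D-P (D-P (un≈ e₂≈0))))
    approx-1≡ : ℚ.- (two ℚ.* (P ℚ.* (harmonic N ℚ.- 0ℚ))) ℚ.+ two ℚ.* (two ℚ.* (P ℚ.* (P ℚ.* (e₂ N ℚ.- 0ℚ)))) ≡ Q₁-approx N ℚ.- 1ℚ
    approx-1≡ = solve 3 (λ P h e → :- ((con 1ℚ :+ con 1ℚ) :* (P :* (h :- con 0ℚ)))
                                     :+ (con 1ℚ :+ con 1ℚ) :* ((con 1ℚ :+ con 1ℚ) :* (P :* (P :* (e :- con 0ℚ))))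
                                  := (con 1ℚ :- (P :+ P) :* h :+ (P :+ P) :* (P :+ P) :* e) :- con 1ℚ)
                        refl P (harmonic N) (e₂ N)

  sgn-N : sgn N ≡ + 1
  sgn-N = trans (cong sgn (cong (h ℕ.+_) (sym (NP.+-identityʳ h)))) (sgn-even h 0)

  Q₁-p≡ : Q₁ p ≡ ℚ.- Q₁ N
  Q₁-p≡ = begin
      ι (sgn p ℤ.* + (M₁ C p))           ≡⟨ cong₂ (λ a b → ι (a ℤ.* + b)) (trans (sgn-suc N) (cong ℤ.-_ sgn-N))
                                                (trans (nCk≡nC[n∸k] (NP.m≤n+m p N)) (cong (M₁ C_) (NP.m+n∸n≡m N p))) ⟩
      ι (ℤ.- (+ 1) ℤ.* + (M₁ C N))       ≡⟨ cong ι (sym (ZP.neg-distribˡ-* (+ 1) (+ (M₁ C N)))) ⟩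
      ι (ℤ.- (+ 1 ℤ.* + (M₁ C N)))       ≡⟨ ι-neg (+ 1 ℤ.* + (M₁ C N)) ⟩
      ℚ.- ι (+ 1 ℤ.* + (M₁ C N))         ≡⟨ cong (λ a → ℚ.- ι (a ℤ.* + (M₁ C N))) (sym sgn-N) ⟩
      ℚ.- Q₁ N                           ∎
    where open ≡-Reasoning

  -- The central term: -C(2p, p) = -2C(2p-1, p-1) ≡ -2 (mod p³).
  t₁-p≈ : t₁ p ≈[ 3 ] ℚ.- (1ℚ ℚ.+ 1ℚ)
  t₁-p≈ = begin
      t₁ (suc N)                  ≡⟨ t-pascal M₁ N ⟩
      Q₁ p ℚ.- Q₁ N               ≡⟨ cong (ℚ._- Q₁ N) Q₁-p≡ ⟩
      ℚ.- Q₁ N ℚ.- Q₁ N           ≈⟨ ≈-+ (≈-neg Q₁-N≈1) (≈-neg Q₁-N≈1) ⟩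
      ℚ.- 1ℚ ℚ.- 1ℚ               ≡⟨ solve 0 (:- con 1ℚ :- con 1ℚ := :- (con 1ℚ :+ con 1ℚ)) refl ⟩
      ℚ.- (1ℚ ℚ.+ 1ℚ)             ∎
    where open ≈-Reasoning

  t₁-sym : ∀ j → j ≤ p → t₁ (p ℕ.+ (p ∸ j)) ≡ t₁ j
  t₁-sym j j≤p = cong₂ (λ a b → ι (a ℤ.* + b)) sgn≡ C≡
    where
    sgn≡ : sgn (p ℕ.+ (p ∸ j)) ≡ sgn j
    sgn≡ = trans (cong sgn (trans (NP.+-comm p (p ∸ j)) (cong ((p ∸ j) ℕ.+_) (sym (NP.m∸n+n≡m j≤p))))) (sgn-even (p ∸ j) j)
    C≡ : (suc M₁ C (p ℕ.+ (p ∸ j))) ≡ (suc M₁ C j)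
    C≡ = trans (nCk≡nC[n∸k] (NP.+-monoʳ-≤ p (NP.m∸n≤m p j)))
               (cong (suc M₁ C_) (trans (NP.[m+n]∸[m+o]≡n∸o p p (p ∸ j)) (NP.m∸[m∸n]≡n j≤p)))

module StatementSums where

  open Casts
  open Sums
  open Selection

  H≡∑ : ∀ r m n → H r m n ≡ ∑ n (λ k → sel (congB k r m) (invℕ k))
  H≡∑ r m zero = refl
  H≡∑ r m (suc n) = cong (ℚ._+ sel (congB (suc n) r m) (invℕ (suc n))) (H≡∑ r m n)

  Ssq≡∑ : ∀ p m n j → Ssq p m n j ≡ ∑ j (λ r → if congB (2 ℕ.* r) p m then 0ℚ else H r m n ℚ.* H r m n)
  Ssq≡∑ p m n zero = refl
  Ssq≡∑ p m n (suc j) =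
    cong (ℚ._+ (if congB (2 ℕ.* suc j) p m then 0ℚ else H (suc j) m n ℚ.* H (suc j) m n)) (Ssq≡∑ p m n j)

  private
    ι-if : ∀ b x → ι (if b then x else + 0) ≡ sel b (ι x)
    ι-if true x = refl
    ι-if false x = refl

  ι-Tpart : ∀ r m n j → ι (Tpart r m n j) ≡
    sel (congB 0 r m) (ι (sgn 0 ℤ.* + (n C 0))) ℚ.+ ∑ j (λ k → sel (congB k r m) (ι (sgn k ℤ.* + (n C k))))
  ι-Tpart r m n zero = trans (ι-if (congB 0 r m) _) (sym (QP.+-identityʳ _))
  ι-Tpart r m n (suc j) = begin
      ι (Tpart r m n j ℤ.+ (if congB (suc j) r m then sgn (suc j) ℤ.* + (n C suc j) else + 0))
        ≡⟨ ι-+ (Tpart r m n j) _ ⟩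
      ι (Tpart r m n j) ℚ.+ ι (if congB (suc j) r m then sgn (suc j) ℤ.* + (n C suc j) else + 0)
        ≡⟨ cong₂ ℚ._+_ (ι-Tpart r m n j) (ι-if (congB (suc j) r m) _) ⟩
      (a₀ ℚ.+ ∑ j g) ℚ.+ g (suc j)
        ≡⟨ QP.+-assoc a₀ (∑ j g) (g (suc j)) ⟩
      a₀ ℚ.+ ∑ (suc j) g ∎
    where
    open ≡-Reasoning
    a₀ = sel (congB 0 r m) (ι (sgn 0 ℤ.* + (n C 0)))
    g : ℕ → ℚ
    g k = sel (congB k r m) (ι (sgn k ℤ.* + (n C k)))

-- The residue-class sums modulo p: 4E + Σ'_r H_{r,m}(p-1)² ≡ 0 (mod p)

module ClassSums (h : ℕ) (pr : Prime (suc (h ℕ.+ h))) (p>3 : 3 < suc (h ℕ.+ h))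
                 (m' : ℕ) (m≥2 : 2 ≤ suc m') (m≢p : suc m' ≢ suc (h ℕ.+ h)) where

  open Casts
  open Sums
  open Selection
  open StatementSums using (H≡∑; Ssq≡∑)
  open Wolstenholme h pr p>3
  open Residues m'

  m∤p : ¬ Cg p 0
  m∤p g with prime⇒irreducible pr (Cg0⇒∣ g)
  ... | inj₁ e = NP.<-irrefl (sym e) m≥2
  ... | inj₂ e = m≢p e

  ≡p? : ℕ → Bool
  ≡p? k = congB k p M

  ≡0? : ℕ → Bool
  ≡0? b = congB b 0 M

  -- p ≡ p, while 0 ≢ p and 2p ≢ p (mod m) since m ∤ p.
  ≡p?-p : ≡p? p ≡ true
  ≡p?-p = congB-refl p

  ≡p?-0 : ≡p? 0 ≡ false
  ≡p?-0 = ¬Cg→congB 0 p (λ g → m∤p (Cg-sym g))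

  ≡p?-2p : ≡p? (p ℕ.+ p) ≡ false
  ≡p?-2p = ¬Cg→congB (p ℕ.+ p) p (λ g → m∤p (Cg-cancel (Cg-eq refl (sym (NP.+-identityʳ p)) g)))

  Hclass : ℕ → ℚ
  Hclass r = ∑ N (λ j → sel (congB j r M) (invℕ j))

  I-Hclass : ∀ r → I (Hclass r)
  I-Hclass r = ∑-I N (λ j pos le → sel-I (congB j r M) (I-invN j pos le))

  -- If 2r ≡ p (mod m), the class of r is closed under j ↦ p - j, so H_{r,m}(p-1) ≡ -H_{r,m}(p-1) ≡ 0.
  Hclass-self-dual : ∀ r → Cg (r ℕ.+ r) p → Hclass r ≈[ 1 ] 0ℚ
  Hclass-self-dual r 2r≡p = half (≈-trans (≈-+ (≈-refl (Hclass r)) Hr≈-Hr) (≈-≡ (QP.+-inverseʳ (Hclass r))))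
    where
    Hr≈-Hr : Hclass r ≈[ 1 ] ℚ.- Hclass r
    Hr≈-Hr = begin
        Hclass r
          ≡⟨ ∑-rev N _ ⟩
        ∑ N (λ j → sel (congB (p ∸ j) r M) (invℕ (p ∸ j)))
          ≡⟨ ∑-cong N (λ j _ le → cong (λ b → sel b (invℕ (p ∸ j))) (self-dual-class p r 2r≡p j (NP.m≤n⇒m≤1+n le))) ⟩
        ∑ N (λ j → sel (congB j r M) (invℕ (p ∸ j)))
          ≈⟨ ∑-≈ N (λ j pos le → sel-≈ (congB j r M) (inv-reflect j pos le)) ⟩
        ∑ N (λ j → sel (congB j r M) (ℚ.- invℕ j))
          ≡⟨ trans (∑-ext N (λ j → sel-neg (congB j r M) (invℕ j))) (∑-neg N _) ⟩
        ℚ.- Hclass r ∎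
      where open ≈-Reasoning

  classSqSum : ℚ
  classSqSum = ∑ M (λ r → Hclass r ℚ.* Hclass r)

  -- The excluded classes 2r ≡ p contribute 0 mod p, so the restricted sum may be completed.
  Ssq≈classSqSum : Ssq p M N M ≈[ 1 ] classSqSum
  Ssq≈classSqSum = ≈-trans (≈-≡ (Ssq≡∑ p M N M)) (∑-≈ M term)
    where
    term : ∀ r → 0 < r → r ≤ M →
      (if congB (2 ℕ.* r) p M then 0ℚ else H r M N ℚ.* H r M N) ≈[ 1 ] (Hclass r ℚ.* Hclass r)
    term r _ _ with congB (2 ℕ.* r) p M in 2r≡p?
    ... | false = ≈-≡ (cong₂ ℚ._*_ (H≡∑ r M N) (H≡∑ r M N))
    ... | true = ≈-sym (≈-trans (≈-* (I-Hclass r) I-0 Hr≈0 Hr≈0) (≈-≡ (QP.*-zeroˡ 0ℚ)))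
      where
      Hr≈0 : Hclass r ≈[ 1 ] 0ℚ
      Hr≈0 = Hclass-self-dual r (Cg-eq (cong (r ℕ.+_) (NP.+-identityʳ r)) refl (congB→Cg (2 ℕ.* r) p 2r≡p?))

  sameClass : ℕ → ℕ → ℚ
  sameClass j k = sel (congB j k M) (invℕ j ℚ.* invℕ k)

  -- Expanding the squares and summing over r: Σ_r H_{r,m}² = Σ_{j,k ≤ N} [j ≡ k]/(jk).
  classSqSum≡Sq : classSqSum ≡ Sq N sameClass
  classSqSum≡Sq = begin
      ∑ M (λ r → Hclass r ℚ.* Hclass r)
        ≡⟨ ∑-ext M (λ r → trans (∑-mul N N _ _)
                 (∑-ext N (λ j → ∑-ext N (λ k → sel-mul (congB j r M) (congB k r M) (invℕ j) (invℕ k))))) ⟩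
      ∑ M (λ r → ∑ N (λ j → ∑ N (λ k → T r j k)))
        ≡⟨ trans (∑-swap M N _) (∑-ext N (λ j → ∑-swap M N _)) ⟩
      ∑ N (λ j → ∑ N (λ k → ∑ M (λ r → T r j k)))
        ≡⟨ ∑-ext N (λ j → ∑-ext N (λ k → pairsum j k (invℕ j ℚ.* invℕ k))) ⟩
      Sq N sameClass ∎
    where
    open ≡-Reasoning
    T : ℕ → ℕ → ℕ → ℚ
    T r j k = sel (congB j r M) (sel (congB k r M) (invℕ j ℚ.* invℕ k))

  F : ℚ
  F = Tri N sameClass

  -- The diagonal of the square is Σ 1/k² ≡ 0, leaving twice the triangle.
  classSqSum≈2F : classSqSum ≈[ 1 ] F ℚ.+ F
  classSqSum≈2F = begin
      classSqSum
        ≡⟨ trans classSqSum≡Sq (Sq-Tri N sameClass) ⟩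
      ∑ N (λ k → sameClass k k) ℚ.+ Tri N (λ j k → sameClass j k ℚ.+ sameClass k j)
        ≡⟨ cong₂ ℚ._+_ (∑-ext N (λ k → cong (λ b → sel b (invℕ k ℚ.* invℕ k)) (congB-refl k)))
                       (trans (Tri-ext N (λ j k → cong (sameClass j k ℚ.+_)
                                                       (cong₂ sel (congB-sym k j) (QP.*-comm (invℕ k) (invℕ j)))))
                              (Tri-+ N sameClass sameClass)) ⟩
      sqSum ℚ.+ (F ℚ.+ F)
        ≈⟨ ≈-+ sqSum≈0 (≈-refl (F ℚ.+ F)) ⟩
      0ℚ ℚ.+ (F ℚ.+ F)
        ≡⟨ QP.+-identityˡ _ ⟩
      F ℚ.+ F ∎
    where open ≈-Reasoning

  third : ℕ → ℕ → ℕ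
  third a b = p ∸ a ∸ b

  module Triple {a b : ℕ} (a>0 : 0 < a) (b>0 : 0 < b) (le : a ℕ.+ b ≤ N) where
    c≡ : third a b ≡ p ∸ (a ℕ.+ b)
    c≡ = NP.∸-+-assoc p a b
    ab≤p : a ℕ.+ b ≤ p
    ab≤p = NP.m≤n⇒m≤1+n le
    a+b+c≡p : (a ℕ.+ b) ℕ.+ third a b ≡ p
    a+b+c≡p = trans (cong ((a ℕ.+ b) ℕ.+_) c≡) (NP.m+[n∸m]≡n ab≤p)
    c>0 : 0 < third a b
    c>0 = subst (0 <_) (sym c≡) (p∸-pos (a ℕ.+ b) le)
    c≤N : third a b ≤ N
    c≤N = subst (_≤ N) (sym c≡) (p∸-le (a ℕ.+ b) (NP.≤-trans a>0 (NP.m≤m+n a b)))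
    a≤N : a ≤ N
    a≤N = NP.≤-trans (NP.m≤m+n a b) le
    b≤N : b ≤ N
    b≤N = NP.≤-trans (NP.m≤n+m b a) le
    a+c≡p-b : a ℕ.+ third a b ≡ p ∸ b
    a+c≡p-b = trans (sym (NP.m+n∸n≡m (a ℕ.+ third a b) b))
      (cong (_∸ b) (trans (NP.+-assoc a (third a b) b)
                   (trans (cong (a ℕ.+_) (NP.+-comm (third a b) b)) (trans (sym (NP.+-assoc a b (third a b))) a+b+c≡p))))
    p-c≡a+b : p ∸ third a b ≡ a ℕ.+ b
    p-c≡a+b = trans (cong (p ∸_) c≡) (NP.m∸[m∸n]≡n ab≤p)
    p-b-a≡c : p ∸ b ∸ a ≡ third a b
    p-b-a≡c = trans (NP.∸-+-assoc p b a) (trans (cong (p ∸_) (NP.+-comm b a)) (sym c≡))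

  -- E = Σ_{k ≤ N, k ≡ p} H_{k-1}/k = Σ_{j<k, k ≡ p} 1/(jk).
  E : ℚ
  E = ∑ N (λ k → sel (≡p? k) (harmonic (k ∸ 1) ℚ.* invℕ k))

  X Y Z : ℚ
  X = AT N (λ a b → sel (≡0? b) (invℕ a ℚ.* invℕ b))
  Y = AT N (λ a b → sel (≡0? b) (invℕ b ℚ.* invℕ (third a b)))
  Z = AT N (λ a b → sel (≡0? b) (invℕ a ℚ.* invℕ (third a b)))

  -- Writing k = a + c with c = p - a - b:  E ≡ -X (mod p).
  E≈-X : E ≈[ 1 ] ℚ.- X
  E≈-X = begin
      E
        ≡⟨ trans (∑-ext N (λ k → trans (cong (sel (≡p? k)) (sym (∑-*ʳ (k ∸ 1) (invℕ k) invℕ))) (sel-∑ (≡p? k) (k ∸ 1) _)))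
                 (Tri-AT N (λ j k → sel (≡p? k) (invℕ j ℚ.* invℕ k))) ⟩
      AT N (λ a b → sel (≡p? (a ℕ.+ b)) (invℕ a ℚ.* invℕ (a ℕ.+ b)))
        ≡⟨ AT-rin N _ ⟩
      AT N (λ a b → sel (≡p? (a ℕ.+ third a b)) (invℕ a ℚ.* invℕ (a ℕ.+ third a b)))
        ≈⟨ AT-≈ N term ⟩
      AT N (λ a b → ℚ.- sel (≡0? b) (invℕ a ℚ.* invℕ b))
        ≡⟨ AT-neg N _ ⟩
      ℚ.- X ∎
    where
    open ≈-Reasoning
    term : ∀ a b → 0 < a → 0 < b → a ℕ.+ b ≤ N →
      sel (≡p? (a ℕ.+ third a b)) (invℕ a ℚ.* invℕ (a ℕ.+ third a b)) ≈[ 1 ] ℚ.- sel (≡0? b) (invℕ a ℚ.* invℕ b)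
    term a b pa pb le = ≈-trans
      (≈-≡ (trans (cong (λ k → sel (≡p? k) (invℕ a ℚ.* invℕ k)) T.a+c≡p-b)
                  (cong (λ z → sel z (invℕ a ℚ.* invℕ (p ∸ b))) (reflect-class p b (NP.m≤n⇒m≤1+n T.b≤N)))))
      (≈-trans (sel-≈ (≡0? b) (≈-scale (invℕ a) (I-invN a pa T.a≤N) (inv-reflect b pb T.b≤N)))
               (≈-≡ (trans (cong (sel (≡0? b)) (sym (QP.neg-distribʳ-* (invℕ a) (invℕ b)))) (sel-neg (≡0? b) _))))
      where module T = Triple pa pb le

  -- The symmetries of the anti-triangle permute the roles of a and c: X = Y.
  X≡Y : X ≡ Y
  X≡Y = begin
      X ≡⟨ AT-swap N _ ⟩
      AT N (λ a b → sel (≡0? a) (invℕ b ℚ.* invℕ a))           ≡⟨ AT-rin N _ ⟩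
      AT N (λ a b → sel (≡0? a) (invℕ (third a b) ℚ.* invℕ a)) ≡⟨ AT-swap N _ ⟩
      AT N (λ a b → sel (≡0? b) (invℕ (p ∸ b ∸ a) ℚ.* invℕ b))
        ≡⟨ AT-ext N (λ a b pa pb le → cong (sel (≡0? b))
                      (trans (cong (λ k → invℕ k ℚ.* invℕ b) (Triple.p-b-a≡c pa pb le)) (QP.*-comm (invℕ (third a b)) (invℕ b)))) ⟩
      Y ∎
    where open ≡-Reasoning

  -- Writing k = a + b with k ≡ j iff b ≡ 0:  F ≡ -Z (mod p).
  F≈-Z : F ≈[ 1 ] ℚ.- Z
  F≈-Z = begin
      F
        ≡⟨ trans (Tri-AT N sameClass)
                 (∑-ext N (λ a → ∑-ext (N ∸ a) (λ b → cong (λ z → sel z (invℕ a ℚ.* invℕ (a ℕ.+ b))) (shift-class a b)))) ⟩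
      AT N (λ a b → sel (≡0? b) (invℕ a ℚ.* invℕ (a ℕ.+ b)))
        ≈⟨ AT-≈ N term ⟩
      AT N (λ a b → ℚ.- sel (≡0? b) (invℕ a ℚ.* invℕ (third a b)))
        ≡⟨ AT-neg N _ ⟩
      ℚ.- Z ∎
    where
    open ≈-Reasoning
    term : ∀ a b → 0 < a → 0 < b → a ℕ.+ b ≤ N →
      sel (≡0? b) (invℕ a ℚ.* invℕ (a ℕ.+ b)) ≈[ 1 ] ℚ.- sel (≡0? b) (invℕ a ℚ.* invℕ (third a b))
    term a b pa pb le = ≈-trans
      (≈-≡ (cong (λ k → sel (≡0? b) (invℕ a ℚ.* invℕ k)) (sym T.p-c≡a+b)))
      (≈-trans (sel-≈ (≡0? b) (≈-scale (invℕ a) (I-invN a pa T.a≤N) (inv-reflect (third a b) T.c>0 T.c≤N)))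
               (≈-≡ (trans (cong (sel (≡0? b)) (sym (QP.neg-distribʳ-* (invℕ a) (invℕ (third a b))))) (sel-neg (≡0? b) _))))
      where module T = Triple pa pb le

  -- 1/(ab) + 1/(bc) + 1/(ac) = p/(abc):  X + Y + Z ≡ 0 (mod p).
  X+Y+Z≈0 : X ℚ.+ Y ℚ.+ Z ≈[ 1 ] 0ℚ
  X+Y+Z≈0 = ≈D (D-eq (sym sum≡) (D-P (I⇒D0 I-W)))
    where
    W = AT N (λ a b → sel (≡0? b) (invℕ a ℚ.* invℕ b ℚ.* invℕ (third a b)))
    I-W : I W
    I-W = AT-I N (λ a b pa pb le → let module T = Triple pa pb le in
      sel-I (≡0? b) (I* (I* (I-invN a pa T.a≤N) (I-invN b pb T.b≤N)) (I-invN (third a b) T.c>0 T.c≤N)))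
    triple : ∀ a b → 0 < a → 0 < b → a ℕ.+ b ≤ N →
      sel (≡0? b) (invℕ a ℚ.* invℕ b) ℚ.+ sel (≡0? b) (invℕ b ℚ.* invℕ (third a b)) ℚ.+ sel (≡0? b) (invℕ a ℚ.* invℕ (third a b))
        ≡ P ℚ.* sel (≡0? b) (invℕ a ℚ.* invℕ b ℚ.* invℕ (third a b))
    triple a b pa pb le = begin
        sel z ab ℚ.+ sel z bc ℚ.+ sel z ac ≡⟨ cong (ℚ._+ sel z ac) (sym (sel-+ z ab bc)) ⟩
        sel z (ab ℚ.+ bc) ℚ.+ sel z ac     ≡⟨ sym (sel-+ z (ab ℚ.+ bc) ac) ⟩
        sel z (ab ℚ.+ bc ℚ.+ ac)           ≡⟨ cong (sel z) (inv-triple a b (third a b) p pa pb T.c>0 T.a+b+c≡p) ⟩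
        sel z (P ℚ.* abc)                  ≡⟨ sel-* z P abc ⟩
        P ℚ.* sel z abc                    ∎
      where
      open ≡-Reasoning
      module T = Triple pa pb le
      z = ≡0? b
      ab = invℕ a ℚ.* invℕ b
      bc = invℕ b ℚ.* invℕ (third a b)
      ac = invℕ a ℚ.* invℕ (third a b)
      abc = invℕ a ℚ.* invℕ b ℚ.* invℕ (third a b)
    sum≡ : X ℚ.+ Y ℚ.+ Z ℚ.- 0ℚ ≡ P ℚ.* W
    sum≡ = begin
        X ℚ.+ Y ℚ.+ Z ℚ.- 0ℚ ≡⟨ QP.+-identityʳ _ ⟩
        X ℚ.+ Y ℚ.+ Z        ≡⟨ sym (trans (AT-+ N _ _) (cong (ℚ._+ Z) (AT-+ N _ _))) ⟩
        AT N (λ a b → sel (≡0? b) (invℕ a ℚ.* invℕ b) ℚ.+ sel (≡0? b) (invℕ b ℚ.* invℕ (third a b))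
                      ℚ.+ sel (≡0? b) (invℕ a ℚ.* invℕ (third a b)))
                             ≡⟨ AT-ext N triple ⟩
        AT N (λ a b → P ℚ.* sel (≡0? b) (invℕ a ℚ.* invℕ b ℚ.* invℕ (third a b)))
                             ≡⟨ AT-* N P _ ⟩
        P ℚ.* W              ∎
      where open ≡-Reasoning

  -- The key congruence: 4E + Σ'_r H_{r,m}(p-1)² ≡ 2(E + E + F) ≡ -2(X + Y + Z) ≡ 0 (mod p).
  E-Ssq≈0 : (1ℚ ℚ.+ 1ℚ) ℚ.* (1ℚ ℚ.+ 1ℚ) ℚ.* E ℚ.+ Ssq p M N M ≈[ 1 ] 0ℚ
  E-Ssq≈0 = begin
      (1ℚ ℚ.+ 1ℚ) ℚ.* (1ℚ ℚ.+ 1ℚ) ℚ.* E ℚ.+ Ssq p M N M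
        ≈⟨ ≈-+ (≈-refl ((1ℚ ℚ.+ 1ℚ) ℚ.* (1ℚ ℚ.+ 1ℚ) ℚ.* E)) (≈-trans Ssq≈classSqSum classSqSum≈2F) ⟩
      (1ℚ ℚ.+ 1ℚ) ℚ.* (1ℚ ℚ.+ 1ℚ) ℚ.* E ℚ.+ (F ℚ.+ F)
        ≡⟨ solve 2 (λ e f → (con 1ℚ :+ con 1ℚ) :* (con 1ℚ :+ con 1ℚ) :* e :+ (f :+ f) := (con 1ℚ :+ con 1ℚ) :* ((e :+ e) :+ f))
                   refl E F ⟩
      (1ℚ ℚ.+ 1ℚ) ℚ.* ((E ℚ.+ E) ℚ.+ F)
        ≈⟨ ≈-scale (1ℚ ℚ.+ 1ℚ) (I+ I-1 I-1) E+E+F≈0 ⟩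
      (1ℚ ℚ.+ 1ℚ) ℚ.* 0ℚ
        ≡⟨ QP.*-zeroʳ (1ℚ ℚ.+ 1ℚ) ⟩
      0ℚ ∎
    where
    open ≈-Reasoning
    E+E+F≈0 : (E ℚ.+ E) ℚ.+ F ≈[ 1 ] 0ℚ
    E+E+F≈0 = ≈-trans (≈-+ (≈-+ E≈-X (≈-trans E≈-X (≈-≡ (cong ℚ.-_ X≡Y)))) F≈-Z)
              (≈-trans (≈-≡ (solve 3 (λ x y z → (:- x :+ :- y) :+ :- z := :- (x :+ y :+ z)) refl X Y Z))
                       (≈-neg X+Y+Z≈0))

-- T*_{p,m}(2p) modulo p³, and the theorem for p = 2h + 1

module MainCongruence (h : ℕ) (pr : Prime (suc (h ℕ.+ h))) (p>3 : 3 < suc (h ℕ.+ h))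
                      (m' : ℕ) (m≥2 : 2 ≤ suc m') (m≢p : suc m' ≢ suc (h ℕ.+ h)) where

  open Casts
  open Sums
  open Selection
  open StatementSums using (H≡∑; ι-Tpart)
  open Wolstenholme h pr p>3
  open BinomialExpansion h pr p>3
  open ClassSums h pr p>3 m' m≥2 m≢p
  open Residues m' using (M; mirror-class)

  g : ℕ → ℚ
  g k = sel (≡p? k) (t₁ k)

  G : ℚ
  G = Hclass p

  -- k = 0 and k = 2p are not ≡ p (mod m), k = p is, and k ↦ 2p - k maps 1..p-1 onto p+1..2p-1:
  -- T*_{p,m}(2p) = 2 Σ_{k<p} g k + t₁ p.
  Tstar-split : ι (Tstar p M (2 ℕ.* p)) ≡ (∑ N g ℚ.+ ∑ N g) ℚ.+ t₁ p
  Tstar-split = begin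
      ι (Tpart p M (2 ℕ.* p) (2 ℕ.* p))
        ≡⟨ cong (λ n → ι (Tpart p M n n)) (cong (p ℕ.+_) (NP.+-identityʳ p)) ⟩
      ι (Tpart p M (p ℕ.+ p) (p ℕ.+ p))
        ≡⟨ ι-Tpart p M (p ℕ.+ p) (p ℕ.+ p) ⟩
      sel (≡p? 0) _ ℚ.+ ∑ (p ℕ.+ p) g
        ≡⟨ cong₂ ℚ._+_ (cong (λ b → sel b (ι (sgn 0 ℤ.* + ((p ℕ.+ p) C 0)))) ≡p?-0) (∑-split p p g) ⟩
      0ℚ ℚ.+ ((∑ N g ℚ.+ g p) ℚ.+ (∑ N (λ i → g (p ℕ.+ i)) ℚ.+ g (p ℕ.+ p)))
        ≡⟨ cong₂ (λ u v → 0ℚ ℚ.+ ((∑ N g ℚ.+ u) ℚ.+ (∑ N (λ i → g (p ℕ.+ i)) ℚ.+ v)))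
                 (cong (λ b → sel b (t₁ p)) ≡p?-p) (cong (λ b → sel b (t₁ (p ℕ.+ p))) ≡p?-2p) ⟩
      0ℚ ℚ.+ ((∑ N g ℚ.+ t₁ p) ℚ.+ (∑ N (λ i → g (p ℕ.+ i)) ℚ.+ 0ℚ))
        ≡⟨ cong (λ u → 0ℚ ℚ.+ ((∑ N g ℚ.+ t₁ p) ℚ.+ (u ℚ.+ 0ℚ))) upper-half ⟩
      0ℚ ℚ.+ ((∑ N g ℚ.+ t₁ p) ℚ.+ (∑ N g ℚ.+ 0ℚ))
        ≡⟨ solve 2 (λ a b → con 0ℚ :+ ((a :+ b) :+ (a :+ con 0ℚ)) := (a :+ a) :+ b) refl (∑ N g) (t₁ p) ⟩
      (∑ N g ℚ.+ ∑ N g) ℚ.+ t₁ p ∎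
    where
    open ≡-Reasoning
    upper-half : ∑ N (λ i → g (p ℕ.+ i)) ≡ ∑ N g
    upper-half = trans (∑-rev N _) (∑-cong N (λ j _ le →
      let j≤p = NP.m≤n⇒m≤1+n le in cong₂ sel (mirror-class p j j≤p) (t₁-sym j j≤p)))

  ∑g≈ : ∑ N g ≈[ 3 ] ℚ.- (A ℚ.* G) ℚ.+ A ℚ.* A ℚ.* E
  ∑g≈ = begin
      ∑ N g
        ≈⟨ ∑-≈ N term ⟩
      ∑ N (λ k → ℚ.- (A ℚ.* sel (≡p? k) (invℕ k)) ℚ.+ A ℚ.* A ℚ.* sel (≡p? k) (harmonic (k ∸ 1) ℚ.* invℕ k))
        ≡⟨ trans (∑-+ N _ _) (cong₂ ℚ._+_ (trans (∑-neg N _) (cong ℚ.-_ (∑-* N A _))) (∑-* N (A ℚ.* A) _)) ⟩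
      ℚ.- (A ℚ.* G) ℚ.+ A ℚ.* A ℚ.* E ∎
    where
    open ≈-Reasoning
    term : ∀ k → 0 < k → k ≤ N →
      g k ≈[ 3 ] ℚ.- (A ℚ.* sel (≡p? k) (invℕ k)) ℚ.+ A ℚ.* A ℚ.* sel (≡p? k) (harmonic (k ∸ 1) ℚ.* invℕ k)
    term (suc k) _ le = ≈-trans (sel-≈ (≡p? (suc k)) (t₁-expansion k le))
      (≈-≡ (trans (sel-+ (≡p? (suc k)) _ _) (cong₂ ℚ._+_
         (trans (sel-neg (≡p? (suc k)) _) (cong ℚ.-_ (sel-* (≡p? (suc k)) A (invℕ (suc k)))))
         (sel-* (≡p? (suc k)) (A ℚ.* A) _))))

  Tstar+2≈ : ι (Tstar p M (2 ℕ.* p) ℤ.+ + 2) ≈[ 3 ] (1ℚ ℚ.+ 1ℚ) ℚ.* (ℚ.- (A ℚ.* G) ℚ.+ A ℚ.* A ℚ.* E)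
  Tstar+2≈ = begin
      ι (Tstar p M (2 ℕ.* p) ℤ.+ + 2)
        ≡⟨ trans (ι-+ (Tstar p M (2 ℕ.* p)) (+ 2)) (cong (ℚ._+ (1ℚ ℚ.+ 1ℚ)) Tstar-split) ⟩
      ((∑ N g ℚ.+ ∑ N g) ℚ.+ t₁ p) ℚ.+ (1ℚ ℚ.+ 1ℚ)
        ≈⟨ ≈-+ (≈-+ (≈-+ ∑g≈ ∑g≈) t₁-p≈) (≈-refl (1ℚ ℚ.+ 1ℚ)) ⟩
      ((W ℚ.+ W) ℚ.+ ℚ.- (1ℚ ℚ.+ 1ℚ)) ℚ.+ (1ℚ ℚ.+ 1ℚ)
        ≡⟨ solve 1 (λ w → ((w :+ w) :+ :- (con 1ℚ :+ con 1ℚ)) :+ (con 1ℚ :+ con 1ℚ) := (con 1ℚ :+ con 1ℚ) :* w) refl W ⟩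
      (1ℚ ℚ.+ 1ℚ) ℚ.* W ∎
    where
    open ≈-Reasoning
    W = ℚ.- (A ℚ.* G) ℚ.+ A ℚ.* A ℚ.* E

  quotient≈ : ℚ.- ι (Tstar p M (2 ℕ.* p) ℤ.+ + 2) ℚ.* invℕ (4 ℕ.* p) ≈[ 2 ] G ℚ.- A ℚ.* E
  quotient≈ = begin
      ℚ.- ι (Tstar p M (2 ℕ.* p) ℤ.+ + 2) ℚ.* invℕ (4 ℕ.* p)
        ≡⟨ cong (ℚ.- ι (Tstar p M (2 ℕ.* p) ℤ.+ + 2) ℚ.*_) (invℕ-* 4 p (s≤s z≤n) (NP.≤-trans (s≤s z≤n) p>3)) ⟩
      ℚ.- ι (Tstar p M (2 ℕ.* p) ℤ.+ + 2) ℚ.* (invℕ 4 ℚ.* invℕ p)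
        ≈⟨ ≈-divP (invℕ 4) (I* I-inv2 I-inv2) (≈-neg Tstar+2≈) ⟩
      ℚ.- ((1ℚ ℚ.+ 1ℚ) ℚ.* (ℚ.- (A ℚ.* G) ℚ.+ A ℚ.* A ℚ.* E)) ℚ.* (invℕ 4 ℚ.* invℕ p)
        ≡⟨ solve 4 (λ P g e i → (:- ((con 1ℚ :+ con 1ℚ) :* (:- ((P :+ P) :* g) :+ (P :+ P) :* (P :+ P) :* e))) :* (con (invℕ 4) :* i)
                              := (g :- (P :+ P) :* e) :* (P :* i)) refl P G E (invℕ p) ⟩
      (G ℚ.- A ℚ.* E) ℚ.* (P ℚ.* invℕ p)
        ≡⟨ trans (cong ((G ℚ.- A ℚ.* E) ℚ.*_) P-inv) (QP.*-identityʳ _) ⟩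
      G ℚ.- A ℚ.* E ∎
    where open ≈-Reasoning

  -- By the key congruence, A·E ≡ -(p/2)·Σ' H_{r,m}(p-1)² (mod p²).
  G≈ : G ≈[ 2 ] (G ℚ.- A ℚ.* E) ℚ.- P ℚ.* invℕ 2 ℚ.* Ssq p M N M
  G≈ = begin
      G
        ≡⟨ solve 2 (λ g P → g := g :- P :* (con (invℕ 2) :* con 0ℚ)) refl G P ⟩
      G ℚ.- P ℚ.* (invℕ 2 ℚ.* 0ℚ)
        ≈⟨ ≈-+ (≈-refl G) (≈-neg (≈-sym (≈-P (≈-scale (invℕ 2) I-inv2 E-Ssq≈0)))) ⟩
      G ℚ.- P ℚ.* (invℕ 2 ℚ.* ((1ℚ ℚ.+ 1ℚ) ℚ.* (1ℚ ℚ.+ 1ℚ) ℚ.* E ℚ.+ Ssq p M N M))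
        ≡⟨ solve 4 (λ g P e s → g :- P :* (con (invℕ 2) :* ((con 1ℚ :+ con 1ℚ) :* (con 1ℚ :+ con 1ℚ) :* e :+ s))
                              := (g :- (P :+ P) :* e) :- P :* con (invℕ 2) :* s) refl G P E (Ssq p M N M) ⟩
      (G ℚ.- A ℚ.* E) ℚ.- P ℚ.* invℕ 2 ℚ.* Ssq p M N M ∎
    where open ≈-Reasoning

  main : H p M N ≡
      ((ℚ.- ((Tstar p M (2 ℕ.* p) ℤ.+ + 2) / 1)) ℚ.* invℕ (4 ℕ.* p)) ℚ.- ((+ p / 2) ℚ.* Ssq p M N M)
    [modsq p ]
  main = ≈2⇒modsq _ _ (begin
      H p M N
        ≡⟨ H≡∑ p M N ⟩
      G
        ≈⟨ G≈ ⟩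
      (G ℚ.- A ℚ.* E) ℚ.- P ℚ.* invℕ 2 ℚ.* Ssq p M N M
        ≈⟨ ≈-+ (≈-sym quotient≈) (≈-≡ (cong (λ z → ℚ.- (z ℚ.* Ssq p M N M)) (sym (/-split (+ p) 1)))) ⟩
      (ℚ.- ι (Tstar p M (2 ℕ.* p) ℤ.+ + 2) ℚ.* invℕ (4 ℕ.* p)) ℚ.- ((+ p / 2) ℚ.* Ssq p M N M) ∎)
    where open ≈-Reasoning

odd-prime : ∀ {p} → Prime p → 2 < p → ∃[ h ] p ≡ suc (h ℕ.+ h)
odd-prime {p} pr 2<p with p ℕ.% 2 in p%2 | m%n<n p 2
... | 0 | _ with prime⇒irreducible pr (divides (p ℕ./ 2) (trans (m≡m%n+[m/n]*n p 2) (cong (ℕ._+ p ℕ./ 2 ℕ.* 2) p%2)))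
...   | inj₁ ()
...   | inj₂ refl = ⊥-elim (NP.n≮n 2 2<p)
odd-prime {p} pr 2<p | 1 | _ = p ℕ./ 2 , (begin
    p                                ≡⟨ m≡m%n+[m/n]*n p 2 ⟩
    p ℕ.% 2 ℕ.+ p ℕ./ 2 ℕ.* 2        ≡⟨ cong (ℕ._+ p ℕ./ 2 ℕ.* 2) p%2 ⟩
    suc (p ℕ./ 2 ℕ.* 2)              ≡⟨ cong suc (trans (NP.*-comm (p ℕ./ 2) 2) (cong (p ℕ./ 2 ℕ.+_) (NP.+-identityʳ (p ℕ./ 2)))) ⟩
    suc (p ℕ./ 2 ℕ.+ p ℕ./ 2)        ∎)
  where open ≡-Reasoning
odd-prime {p} pr 2<p | suc (suc _) | s≤s (s≤s ())

theorem1p2 : (m p : ℕ) → 2 ≤ m → Prime p → 3 < p → p ≢ m →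
    H p m (p ∸ 1) ≡
      ((ℚ.- ((Tstar p m (2 ℕ.* p) ℤ.+ + 2) / 1)) ℚ.* invℕ (4 ℕ.* p))
        ℚ.- ((+ p / 2) ℚ.* Ssq p m (p ∸ 1) m)
      [modsq p ]
theorem1p2 (suc m') p m≥2 pr p>3 p≢m with odd-prime pr (NP.<-trans (s≤s (s≤s (s≤s z≤n))) p>3)
... | h , refl = MainCongruence.main h pr p>3 m' m≥2 (λ m≡p → p≢m (sym m≡p))
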